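{- Let $S\in\mathcal{I}_1\cap\mathcal{I}_2$ be such that the shortest $s$–$t$ path in $G(S)$ has length $2(\ell+1)$, and let $\Pi_\ell$ be an augmenting set in $G(S)$ of width $w$. Then there exists an ordered collection $\mathcal{P}$ of $w$ consecutive shortest augmenting paths in $G(S)$.
   Context: $\mathcal{M}_1=(V,\mathcal{I}_1)$, $\mathcal{M}_2=(V,\mathcal{I}_2)$ are matroids. For $S\in\mathcal{I}_1\cap\mathcal{I}_2$, the exchange graph $G(S)$ is the directed graph on $V\cup\{s,t\}$ with arcs: $(s,a)$ for $a\notin S$ with $S+a\in\mathcal{I}_1$; $(a,t)$ for $a\notin S$ with $S+a\in\mathcal{I}_2$; $(a,b)$ for $a\in S$, $b\notin S$ with $S-a+b\in\mathcal{I}_1$; $(b,a)$ for $a\in S$, $b\notin S$ with $S-a+b\in\mathcal{I}_2$. $D_i$ is the set of elements at distance exactly $i$ from $s$ in $G(S)$. An augmenting set in $G(S)$ is a sequence $(B_1,A_1,\dots,A_\ell,B_{\ell+1})$ with: (a) $A_k\subseteq D_{2k}$, $B_k\subseteq D_{2k-1}$; (b) all sets have the same size $w$ (the width); (c) $S+B_1\in\mathcal{I}_1$; (d) $S+B_{\ell+1}\in\mathcal{I}_2$; (e) $S-A_k+B_{k+1}\in\mathcal{I}_1$ for $1\le k\le\ell$; (f) $S-A_k+B_k\in\mathcal{I}_2$ for $1\le k\le\ell$. Augmenting along a path $s,v_1,\dots,v_a,t$ replaces $S$ by $S+v_1-v_2+\cdots+v_a$. An ordered collection $(p_1,\dots,p_k)$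 is a collection of consecutive shortest augmenting paths in $G(S)$ if each $p_i$ has length $2(\ell+1)$ and is an $s$–$t$ path in $G(S_i)$, where $S_i$ is obtained from $S$ by augmenting along $p_1,\dots,p_{i-1}$ in order. -}

module Defs where

open import Data.Nat using (ℕ; zero; suc; _+_; _*_; _≤_; _<_)
open import Data.Fin using (Fin; zero; suc; inject₁; fromℕ)
open import Data.Fin.Subset using (Subset; ⁅_⁆; _∈_; _∉_; _⊆_; _∪_; _─_; _-_; ∣_∣; ⊥)
open import Data.List using (List; []; _∷_; length)
open import Data.List.Relation.Unary.Unique.Propositional using (Unique)
open import Data.Product using (Σ; _×_; ∃; ∃-syntax; _,_)
open import Data.Unit using (⊤)
open import Relation.Binary.PropositionalEquality using (_≡_)

record Matroid (n : ℕ) : Set₁ where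
  field
    Indep      : Subset n → Set
    indep-∅    : Indep ⊥
    indep-⊆    : ∀ {A B} → A ⊆ B → Indep B → Indep A
    indep-exch : ∀ {A B} → Indep A → Indep B → ∣ A ∣ < ∣ B ∣ →
                 ∃[ x ] (x ∈ B × x ∉ A × Indep (A ∪ ⁅ x ⁆))
open Matroid public

data Node (n : ℕ) : Set where
  s t : Node n
  el  : Fin n → Node n

data Arc {n : ℕ} (M₁ M₂ : Matroid n) (S : Subset n) : Node n → Node n → Set where
  arc-s  : ∀ {a} → a ∉ S → Indep M₁ (S ∪ ⁅ a ⁆) → Arc M₁ M₂ S s (el a)
  arc-t  : ∀ {a} → a ∉ S → Indep M₂ (S ∪ ⁅ a ⁆) → Arc M₁ M₂ S (el a) t
  arc-ab : ∀ {a b} → a ∈ S → b ∉ S → Indep M₁ ((S - a) ∪ ⁅ b ⁆) → Arc M₁ M₂ S (el a) (el b)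
  arc-ba : ∀ {a b} → a ∈ S → b ∉ S → Indep M₂ ((S - a) ∪ ⁅ b ⁆) → Arc M₁ M₂ S (el b) (el a)

data Walk {n : ℕ} (M₁ M₂ : Matroid n) (S : Subset n) : Node n → Node n → ℕ → Set where
  [] : ∀ {u} → Walk M₁ M₂ S u u 0
  _∷_ : ∀ {u v w k} → Arc M₁ M₂ S u v → Walk M₁ M₂ S v w k → Walk M₁ M₂ S u w (suc k)

DistFromS : ∀ {n} → Matroid n → Matroid n → Subset n → Node n → ℕ → Set
DistFromS M₁ M₂ S v i = Walk M₁ M₂ S s v i × (∀ j → Walk M₁ M₂ S s v j → i ≤ j)

InD : ∀ {n} → Matroid n → Matroid n → Subset n → ℕ → Fin n → Set
InD M₁ M₂ S i a = DistFromS M₁ M₂ S (el a) i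

-- Augmenting set (B₁, A₁, …, A_ℓ, B_{ℓ+1}) of width w.
-- B k represents B_{k+1} (k : Fin (ℓ+1)), A k represents A_{k+1} (k : Fin ℓ).
record AugmentingSet {n : ℕ} (M₁ M₂ : Matroid n) (S : Subset n) (ℓ w : ℕ) : Set where
  field
    B : Fin (suc ℓ) → Subset n
    A : Fin ℓ → Subset n
    A⊆D : ∀ (k : Fin ℓ) a → a ∈ A k → InD M₁ M₂ S (2 * suc (Data.Fin.toℕ k)) a
    B⊆D : ∀ (k : Fin (suc ℓ)) b → b ∈ B k → InD M₁ M₂ S (suc (2 * Data.Fin.toℕ k)) b
    ∣A∣ : ∀ k → ∣ A k ∣ ≡ w
    ∣B∣ : ∀ k → ∣ B k ∣ ≡ w
    first : Indep M₁ (S ∪ B zero)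
    last  : Indep M₂ (S ∪ B (fromℕ ℓ))
    exch₁ : ∀ (k : Fin ℓ) → Indep M₁ ((S ─ A k) ∪ B (suc k))
    exch₂ : ∀ (k : Fin ℓ) → Indep M₂ ((S ─ A k) ∪ B (inject₁ k))

data ArcChain {n : ℕ} (M₁ M₂ : Matroid n) (S : Subset n) : Node n → List (Fin n) → Set where
  end  : ∀ {u} → Arc M₁ M₂ S u t → ArcChain M₁ M₂ S u []
  step : ∀ {u v vs} → Arc M₁ M₂ S u (el v) → ArcChain M₁ M₂ S (el v) vs → ArcChain M₁ M₂ S u (v ∷ vs)

IsSTPath : ∀ {n} → Matroid n → Matroid n → Subset n → List (Fin n) → Set
IsSTPath M₁ M₂ S vs = ArcChain M₁ M₂ S s vs × Unique vs

mutual
  augAdd : ∀ {n} → Subset n → List (Fin n) → Subset n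
  augAdd S []       = S
  augAdd S (v ∷ vs) = augRem (S ∪ ⁅ v ⁆) vs

  augRem : ∀ {n} → Subset n → List (Fin n) → Subset n
  augRem S []       = S
  augRem S (v ∷ vs) = augAdd (S - v) vs

augment : ∀ {n} → Subset n → List (Fin n) → Subset n
augment = augAdd

-- (p₁, …, p_k) consecutive shortest augmenting paths in G(S): each p_i has
-- length 2(ℓ+1) (i.e. a+1 arcs) and is an s–t path in G(S_i).
ConsecutiveShortest : ∀ {n} → Matroid n → Matroid n → ℕ → Subset n → List (List (Fin n)) → Set
ConsecutiveShortest M₁ M₂ ℓ S []       = ⊤
ConsecutiveShortest M₁ M₂ ℓ S (p ∷ ps) =
  (suc (length p) ≡ 2 * suc ℓ) × IsSTPath M₁ M₂ S p × ConsecutiveShortest M₁ M₂ ℓ (augment S p) ps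

module Submission where

-- Starting from any b₁ ∈ B₁, walk greedily through the layers: some a₁ ∈ A₁ can be exchanged
-- for b₁ in M₂ (since S − A₁ + B₁ ∈ I₂), then some b₂ ∈ B₂ for a₁ in M₁ (since S − A₁ + B₂ ∈ I₁),
-- and so on up to b_{ℓ+1} ∈ B_{ℓ+1}; with s and t this is an s–t path with 2(ℓ+1) arcs.
-- After augmenting along it and deleting its vertices from the layers, the distances may change,
-- but the layers keep two properties for each matroid separately: the layer exchanges stay
-- independent, and no arc leads from S or a layer directly into a later layer. These are shown for
-- the new set by exchanging the layers one at a time (each exchange stays independent because the
-- remaining part of S spans the incoming layer), and they are all the greedy walk needs, so
-- induction on the width w gives w consecutive paths.

open import Defs
open import Data.Nat using (ℕ; zero; suc; _+_; _*_; _∸_; _≤_; _<_; z≤n; s≤s; pred; _≤?_; _≟_; >-nonZero)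
open import Data.Nat.Properties
open import Data.Fin using (Fin; zero; suc; toℕ; fromℕ; fromℕ<; inject₁)
open import Data.Fin.Properties using (toℕ-fromℕ; toℕ-fromℕ<; toℕ-inject₁)
open import Data.Fin.Subset using (Subset; inside; outside; _∈_; _∉_; _⊆_; _∪_; _─_; _-_; ⁅_⁆; ∣_∣)
open import Data.Fin.Subset.Properties
  using (x∈p∪q⁺; x∈p∪q⁻; x∈p∧x∉q⇒x∈p─q; p─q⊆p; x∈⁅x⁆; x∈⁅y⁆⇒x≡y; ∣⁅x⁆∣≡1; drop-∷-⊆; p⊆q⇒∣p∣≤∣q∣; _∈?_)
open import Data.Vec.Base using ([]; _∷_; here; there)
open import Data.List using (List; []; _∷_; length)
open import Data.List.Relation.Unary.All using (All; []; _∷_)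
open import Data.List.Relation.Unary.AllPairs using ([]; _∷_)
open import Data.List.Relation.Unary.Unique.Propositional using (Unique)
open import Data.Product using (∃; ∃-syntax; _×_; _,_; proj₁; proj₂)
open import Data.Sum using (_⊎_; inj₁; inj₂; [_,_]′)
open import Data.Empty using (⊥; ⊥-elim)
open import Data.Unit using (tt)
open import Data.Bool using (Bool; true; false; not)
open import Data.Bool.Properties using (not-involutive)
open import Relation.Nullary using (¬_; yes; no; does)
open import Relation.Nullary.Decidable using (dec-true; dec-false)
open import Relation.Binary.PropositionalEquality using (_≡_; _≢_; refl; sym; trans; cong; subst; module ≡-Reasoning)

─ʳ : ∀ {n} {p q : Subset n} {x} → x ∈ p ─ q → x ∉ q
─ʳ {p = _ ∷ p} {inside ∷ q}  (there h) (there h′) = ─ʳ {p = p} {q} h h′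
─ʳ {p = _ ∷ p} {outside ∷ q} (there h) (there h′) = ─ʳ {p = p} {q} h h′

module _ {n : ℕ} where

  ∪ˡ : ∀ {p q : Subset n} {x} → x ∈ p → x ∈ p ∪ q
  ∪ˡ h = x∈p∪q⁺ (inj₁ h)

  ∪ʳ : ∀ {p q : Subset n} {x} → x ∈ q → x ∈ p ∪ q
  ∪ʳ h = x∈p∪q⁺ (inj₂ h)

  ∪⁻ : ∀ {p q : Subset n} {x} → x ∈ p ∪ q → x ∈ p ⊎ x ∈ q
  ∪⁻ {p} {q} = x∈p∪q⁻ p q

  ─⁺ : ∀ {p q : Subset n} {x} → x ∈ p → x ∉ q → x ∈ p ─ q
  ─⁺ = x∈p∧x∉q⇒x∈p─q

  ─ˡ : ∀ {p q : Subset n} {x} → x ∈ p ─ q → x ∈ p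
  ─ˡ {p} {q} = p─q⊆p p q

  ⁅⁆⁻ : ∀ {x y : Fin n} → y ∈ ⁅ x ⁆ → y ≡ x
  ⁅⁆⁻ {x} = x∈⁅y⁆⇒x≡y x

  -⁺ : ∀ {p : Subset n} {x y} → x ∈ p → x ≢ y → x ∈ p - y
  -⁺ h x≢y = ─⁺ h (λ h′ → x≢y (⁅⁆⁻ h′))

  -ˡ : ∀ {p : Subset n} {x y} → x ∈ p - y → x ∈ p
  -ˡ = ─ˡ

  -ʳ : ∀ {p : Subset n} {x y} → x ∈ p - y → x ≢ y
  -ʳ {y = y} h refl = ─ʳ h (x∈⁅x⁆ y)

  ∈⁅⁆⇒⊆ : ∀ {p : Subset n} {x} → x ∈ p → ⁅ x ⁆ ⊆ p
  ∈⁅⁆⇒⊆ {p} h h′ = subst (_∈ p) (sym (⁅⁆⁻ h′)) h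

  ∪⁅⁆-⊆ : ∀ {p q : Subset n} {x} → p ⊆ q → x ∈ q → p ∪ ⁅ x ⁆ ⊆ q
  ∪⁅⁆-⊆ p⊆q x∈q h = [ p⊆q , ∈⁅⁆⇒⊆ x∈q ]′ (∪⁻ h)

  ∪-mono : ∀ {p p′ q q′ : Subset n} → p ⊆ p′ → q ⊆ q′ → p ∪ q ⊆ p′ ∪ q′
  ∪-mono p⊆p′ q⊆q′ h = [ (λ h′ → ∪ˡ (p⊆p′ h′)) , (λ h′ → ∪ʳ (q⊆q′ h′)) ]′ (∪⁻ h)

∣p∪q∣≡∣p∣+∣q∣ : ∀ {n} (p q : Subset n) → (∀ {x} → x ∈ p → x ∉ q) → ∣ p ∪ q ∣ ≡ ∣ p ∣ + ∣ q ∣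
∣p∪q∣≡∣p∣+∣q∣ []            []            _  = refl
∣p∪q∣≡∣p∣+∣q∣ (inside ∷ p)  (inside ∷ q)  pq = ⊥-elim (pq here here)
∣p∪q∣≡∣p∣+∣q∣ (inside ∷ p)  (outside ∷ q) pq = cong suc (∣p∪q∣≡∣p∣+∣q∣ p q (λ h h′ → pq (there h) (there h′)))
∣p∪q∣≡∣p∣+∣q∣ (outside ∷ p) (inside ∷ q)  pq =
  trans (cong suc (∣p∪q∣≡∣p∣+∣q∣ p q (λ h h′ → pq (there h) (there h′)))) (sym (+-suc ∣ p ∣ ∣ q ∣))
∣p∪q∣≡∣p∣+∣q∣ (outside ∷ p) (outside ∷ q) pq = ∣p∪q∣≡∣p∣+∣q∣ p q (λ h h′ → pq (there h) (there h′))

∣p─q∣+∣q∣≡∣p∣ : ∀ {n} (p q : Subset n) → q ⊆ p → ∣ p ─ q ∣ + ∣ q ∣ ≡ ∣ p ∣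
∣p─q∣+∣q∣≡∣p∣ []            []            _   = refl
∣p─q∣+∣q∣≡∣p∣ (inside ∷ p)  (inside ∷ q)  q⊆p = trans (+-suc _ _) (cong suc (∣p─q∣+∣q∣≡∣p∣ p q (drop-∷-⊆ q⊆p)))
∣p─q∣+∣q∣≡∣p∣ (inside ∷ p)  (outside ∷ q) q⊆p = cong suc (∣p─q∣+∣q∣≡∣p∣ p q (drop-∷-⊆ q⊆p))
∣p─q∣+∣q∣≡∣p∣ (outside ∷ p) (outside ∷ q) q⊆p = ∣p─q∣+∣q∣≡∣p∣ p q (drop-∷-⊆ q⊆p)
∣p─q∣+∣q∣≡∣p∣ (outside ∷ p) (inside ∷ q)  q⊆p with q⊆p here
... | ()

⊆∧∣∣≤⇒⊇ : ∀ {n} (p q : Subset n) → p ⊆ q → ∣ q ∣ ≤ ∣ p ∣ → q ⊆ p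
⊆∧∣∣≤⇒⊇ (inside ∷ p)  (inside ∷ q)  p⊆q _         here      = here
⊆∧∣∣≤⇒⊇ (inside ∷ p)  (inside ∷ q)  p⊆q (s≤s q≤p) (there h) = there (⊆∧∣∣≤⇒⊇ p q (drop-∷-⊆ p⊆q) q≤p h)
⊆∧∣∣≤⇒⊇ (outside ∷ p) (outside ∷ q) p⊆q q≤p       (there h) = there (⊆∧∣∣≤⇒⊇ p q (drop-∷-⊆ p⊆q) q≤p h)
⊆∧∣∣≤⇒⊇ (inside ∷ p)  (outside ∷ q) p⊆q _         _         with p⊆q here
... | ()
⊆∧∣∣≤⇒⊇ (outside ∷ p) (inside ∷ q)  p⊆q q≤p       _         =
  ⊥-elim (<-irrefl refl (≤-trans q≤p (p⊆q⇒∣p∣≤∣q∣ (drop-∷-⊆ p⊆q))))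

⊆∧∣∣<⇒∃∉ : ∀ {n} (p q : Subset n) → p ⊆ q → ∣ p ∣ < ∣ q ∣ → ∃ λ x → x ∈ q × x ∉ p
⊆∧∣∣<⇒∃∉ (outside ∷ p) (inside ∷ q)  _   _         = zero , here , λ ()
⊆∧∣∣<⇒∃∉ (inside ∷ p)  (inside ∷ q)  p⊆q (s≤s p<q) with ⊆∧∣∣<⇒∃∉ p q (drop-∷-⊆ p⊆q) p<q
... | x , x∈q , x∉p = suc x , there x∈q , λ { (there h) → x∉p h }
⊆∧∣∣<⇒∃∉ (outside ∷ p) (outside ∷ q) p⊆q p<q       with ⊆∧∣∣<⇒∃∉ p q (drop-∷-⊆ p⊆q) p<q
... | x , x∈q , x∉p = suc x , there x∈q , λ { (there h) → x∉p h }
⊆∧∣∣<⇒∃∉ (inside ∷ p)  (outside ∷ q) p⊆q _         with p⊆q here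
... | ()

∣p∣>0⇒∃∈ : ∀ {n} (p : Subset n) → 0 < ∣ p ∣ → ∃ λ x → x ∈ p
∣p∣>0⇒∃∈ (inside ∷ p)  _   = zero , here
∣p∣>0⇒∃∈ (outside ∷ p) p>0 with ∣p∣>0⇒∃∈ p p>0
... | x , x∈p = suc x , there x∈p

∣p∪⁅x⁆∣≡1+∣p∣ : ∀ {n} (p : Subset n) x → x ∉ p → ∣ p ∪ ⁅ x ⁆ ∣ ≡ suc ∣ p ∣
∣p∪⁅x⁆∣≡1+∣p∣ p x x∉p = begin
  ∣ p ∪ ⁅ x ⁆ ∣     ≡⟨ ∣p∪q∣≡∣p∣+∣q∣ p ⁅ x ⁆ (λ h h′ → x∉p (subst (_∈ p) (⁅⁆⁻ h′) h)) ⟩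
  ∣ p ∣ + ∣ ⁅ x ⁆ ∣ ≡⟨ cong (∣ p ∣ +_) (∣⁅x⁆∣≡1 x) ⟩
  ∣ p ∣ + 1         ≡⟨ +-comm ∣ p ∣ 1 ⟩
  suc ∣ p ∣         ∎
  where open ≡-Reasoning

1+∣p-x∣≡∣p∣ : ∀ {n} (p : Subset n) x → x ∈ p → suc ∣ p - x ∣ ≡ ∣ p ∣
1+∣p-x∣≡∣p∣ p x x∈p = begin
  suc ∣ p - x ∣         ≡⟨ +-comm 1 _ ⟩
  ∣ p - x ∣ + 1         ≡⟨ cong (∣ p - x ∣ +_) (sym (∣⁅x⁆∣≡1 x)) ⟩
  ∣ p - x ∣ + ∣ ⁅ x ⁆ ∣ ≡⟨ ∣p─q∣+∣q∣≡∣p∣ p ⁅ x ⁆ (∈⁅⁆⇒⊆ x∈p) ⟩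
  ∣ p ∣                 ∎
  where open ≡-Reasoning

∣[p─q]∪r∣≡∣p∣ : ∀ {n} (p q r : Subset n) → q ⊆ p → (∀ {x} → x ∈ r → x ∉ p) → ∣ q ∣ ≡ ∣ r ∣ →
                ∣ (p ─ q) ∪ r ∣ ≡ ∣ p ∣
∣[p─q]∪r∣≡∣p∣ p q r q⊆p r∩p=∅ ∣q∣≡∣r∣ = begin
  ∣ (p ─ q) ∪ r ∣   ≡⟨ ∣p∪q∣≡∣p∣+∣q∣ (p ─ q) r (λ h h′ → r∩p=∅ h′ (─ˡ h)) ⟩
  ∣ p ─ q ∣ + ∣ r ∣ ≡⟨ cong (∣ p ─ q ∣ +_) (sym ∣q∣≡∣r∣) ⟩
  ∣ p ─ q ∣ + ∣ q ∣ ≡⟨ ∣p─q∣+∣q∣≡∣p∣ p q q⊆p ⟩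
  ∣ p ∣             ∎
  where open ≡-Reasoning

module MatroidProperties {n : ℕ} (M : Matroid n) where

  I : Subset n → Set
  I = Indep M

  record Extension (Q T : Subset n) : Set where
    field
      set   : Subset n
      indep : I set
      ⊇Q    : Q ⊆ set
      ⊆Q∪T  : set ⊆ Q ∪ T
      card  : ∣ set ∣ ≡ ∣ T ∣

  private
    extendBy : ∀ d {Q T} → I Q → I T → ∣ Q ∣ + d ≡ ∣ T ∣ → Extension Q T
    extendBy zero {Q} iQ _ e = record
      { set = Q ; indep = iQ ; ⊇Q = λ h → h ; ⊆Q∪T = ∪ˡ ; card = trans (sym (+-identityʳ _)) e }
    extendBy (suc d) {Q} {T} iQ iT e
      with indep-exch M iQ iT (subst (∣ Q ∣ <_) e (m<m+n ∣ Q ∣ (s≤s z≤n)))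
    ... | x , x∈T , x∉Q , iQx = record
      { set = set ; indep = indep ; ⊇Q = λ h → ⊇Q (∪ˡ h) ; ⊆Q∪T = ⊆Q∪T′ ; card = card }
      where
      open Extension (extendBy d iQx iT (trans (cong (_+ d) (∣p∪⁅x⁆∣≡1+∣p∣ Q x x∉Q)) (trans (sym (+-suc _ _)) e)))
      ⊆Q∪T′ : set ⊆ Q ∪ T
      ⊆Q∪T′ h = [ ∪-mono (λ h′ → h′) (∈⁅⁆⇒⊆ x∈T) , ∪ʳ ]′ (∪⁻ (⊆Q∪T h))

  extend : ∀ {Q T} → I Q → I T → ∣ Q ∣ ≤ ∣ T ∣ → Extension Q T
  extend {Q} {T} iQ iT Q≤T = extendBy (∣ T ∣ ∸ ∣ Q ∣) iQ iT (m+[n∸m]≡n Q≤T)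

  spanned⇒∣∣≤ : ∀ {X Z} → I X → I Z → (∀ {x} → x ∈ Z → x ∉ X → ¬ I (X ∪ ⁅ x ⁆)) → ∣ Z ∣ ≤ ∣ X ∣
  spanned⇒∣∣≤ {X} {Z} iX iZ spanned with ∣ Z ∣ ≤? ∣ X ∣
  ... | yes Z≤X = Z≤X
  ... | no  Z≰X with indep-exch M iX iZ (≰⇒> Z≰X)
  ... | x , x∈Z , x∉X , iXx = ⊥-elim (spanned x∈Z x∉X iXx)

  -- Extend Q to a basis of S + z: it misses exactly one element e of S, and e ∉ Q.
  exchange-into : ∀ {S Q z} → I S → z ∉ S → I Q → z ∈ Q → Q ⊆ S ∪ ⁅ z ⁆ → ∣ Q ∣ ≤ ∣ S ∣ →
                  ∃ λ e → e ∈ S × e ∉ Q × I ((S - e) ∪ ⁅ z ⁆)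
  exchange-into {S} {Q} {z} iS z∉S iQ z∈Q Q⊆S+z Q≤S =
    drop-missing (⊆∧∣∣<⇒∃∉ Q′ (S ∪ ⁅ z ⁆) Q′⊆S+z (≤-reflexive (sym ∣S+z∣)))
    where
    open Extension (extend iQ iS Q≤S) renaming (set to Q′)
    ∣S+z∣ : ∣ S ∪ ⁅ z ⁆ ∣ ≡ suc ∣ Q′ ∣
    ∣S+z∣ = trans (∣p∪⁅x⁆∣≡1+∣p∣ S z z∉S) (cong suc (sym card))
    Q′⊆S+z : Q′ ⊆ S ∪ ⁅ z ⁆
    Q′⊆S+z h = [ Q⊆S+z , ∪ˡ ]′ (∪⁻ (⊆Q∪T h))
    drop-missing : (∃ λ e → e ∈ S ∪ ⁅ z ⁆ × e ∉ Q′) → ∃ λ e → e ∈ S × e ∉ Q × I ((S - e) ∪ ⁅ z ⁆)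
    drop-missing (e , e∈S+z , e∉Q′) = e , e∈S , (λ h → e∉Q′ (⊇Q h)) , indep-⊆ M S-e+z⊆Q′ indep
      where
      e≢z : e ≢ z
      e≢z refl = e∉Q′ (⊇Q z∈Q)
      e∈S : e ∈ S
      e∈S = [ (λ h → h) , (λ h → ⊥-elim (e≢z (⁅⁆⁻ h))) ]′ (∪⁻ e∈S+z)
      Q′⊆S+z-e : Q′ ⊆ (S ∪ ⁅ z ⁆) - e
      Q′⊆S+z-e h = -⁺ (Q′⊆S+z h) (λ { refl → e∉Q′ h })
      S-e+z⊆S+z-e : (S - e) ∪ ⁅ z ⁆ ⊆ (S ∪ ⁅ z ⁆) - e
      S-e+z⊆S+z-e h = [ (λ h′ → -⁺ (∪ˡ (-ˡ h′)) (-ʳ h′)) , (λ h′ → -⁺ (∪ʳ h′) (λ { refl → e≢z (⁅⁆⁻ h′) })) ]′ (∪⁻ h)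
      S-e+z⊆Q′ : (S - e) ∪ ⁅ z ⁆ ⊆ Q′
      S-e+z⊆Q′ h = ⊆∧∣∣≤⇒⊇ Q′ _ Q′⊆S+z-e (≤-reflexive (suc-injective (trans (1+∣p-x∣≡∣p∣ _ e (∪ˡ e∈S)) ∣S+z∣)))
                     (S-e+z⊆S+z-e h)

  -- The unique circuit of S + z lies inside W + z.
  ¬indep-∪⁅⁆-restrict : ∀ {S W z} → I S → z ∉ S → ¬ I (S ∪ ⁅ z ⁆) → W ⊆ S →
                        (∀ {e} → e ∈ S → e ∉ W → ¬ I ((S - e) ∪ ⁅ z ⁆)) → ¬ I (W ∪ ⁅ z ⁆)
  ¬indep-∪⁅⁆-restrict {S} {W} {z} iS z∉S ¬iS+z W⊆S unexchangeable iW+z =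
    contradict (exchange-into iS z∉S iW+z (∪ʳ (x∈⁅x⁆ z)) (∪-mono W⊆S (λ h → h)) (spanned⇒∣∣≤ iS iW+z z-spanned))
    where
    z-spanned : ∀ {x} → x ∈ W ∪ ⁅ z ⁆ → x ∉ S → ¬ I (S ∪ ⁅ x ⁆)
    z-spanned x∈W+z x∉S with ∪⁻ x∈W+z
    ... | inj₁ x∈W = ⊥-elim (x∉S (W⊆S x∈W))
    ... | inj₂ x∈z rewrite ⁅⁆⁻ x∈z = ¬iS+z
    contradict : ¬ ∃ λ e → e ∈ S × e ∉ W ∪ ⁅ z ⁆ × I ((S - e) ∪ ⁅ z ⁆)
    contradict (e , e∈S , e∉W+z , iS-e+z) = unexchangeable e∈S (λ e∈W → e∉W+z (∪ˡ e∈W)) iS-e+z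

  exchange-into-block : ∀ {S Y Z b} → I S → I ((S ─ Y) ∪ Z) → b ∈ Z → b ∉ S → Y ⊆ S → 1 ≤ ∣ Y ∣ →
                        ∃ λ a → a ∈ Y × I ((S - a) ∪ ⁅ b ⁆)
  exchange-into-block {S} {Y} {Z} {b} iS iS─Y∪Z b∈Z b∉S Y⊆S 1≤Y =
    inside-Y (exchange-into iS b∉S (indep-⊆ M (∪-mono (λ h → h) (∈⁅⁆⇒⊆ b∈Z)) iS─Y∪Z) (∪ʳ (x∈⁅x⁆ b))
                            (∪-mono ─ˡ (λ h → h)) Q≤S)
    where
    Q≤S : ∣ (S ─ Y) ∪ ⁅ b ⁆ ∣ ≤ ∣ S ∣
    Q≤S = begin
      ∣ (S ─ Y) ∪ ⁅ b ⁆ ∣ ≡⟨ ∣p∪⁅x⁆∣≡1+∣p∣ (S ─ Y) b (λ h → b∉S (─ˡ h)) ⟩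
      1 + ∣ S ─ Y ∣       ≡⟨ +-comm 1 _ ⟩
      ∣ S ─ Y ∣ + 1       ≤⟨ +-monoʳ-≤ ∣ S ─ Y ∣ 1≤Y ⟩
      ∣ S ─ Y ∣ + ∣ Y ∣   ≡⟨ ∣p─q∣+∣q∣≡∣p∣ S Y Y⊆S ⟩
      ∣ S ∣               ∎
      where open ≤-Reasoning
    inside-Y : (∃ λ e → e ∈ S × e ∉ (S ─ Y) ∪ ⁅ b ⁆ × I ((S - e) ∪ ⁅ b ⁆)) → ∃ λ a → a ∈ Y × I ((S - a) ∪ ⁅ b ⁆)
    inside-Y (e , e∈S , e∉Q , iS-e+b) with e ∈? Y
    ... | yes e∈Y = e , e∈Y , iS-e+b
    ... | no  e∉Y = ⊥-elim (e∉Q (∪ˡ (─⁺ e∈S e∉Y)))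

  exchange-out-of-block : ∀ {S Y Z a} → I S → I ((S ─ Y) ∪ Z) → a ∈ Y → Y ⊆ S →
                          (∀ {z} → z ∈ Z → z ∉ S) → ∣ Y ∣ ≡ ∣ Z ∣ →
                          ∃ λ b → b ∈ Z × I ((S - a) ∪ ⁅ b ⁆)
  exchange-out-of-block {S} {Y} {Z} {a} iS iS─Y∪Z a∈Y Y⊆S Z∩S=∅ ∣Y∣≡∣Z∣ =
    inside-Z (indep-exch M (indep-⊆ M -ˡ iS) iS─Y∪Z S-a<S─Y∪Z)
    where
    S-a<S─Y∪Z : ∣ S - a ∣ < ∣ (S ─ Y) ∪ Z ∣
    S-a<S─Y∪Z = subst (∣ S - a ∣ <_) (sym (∣[p─q]∪r∣≡∣p∣ S Y Z Y⊆S Z∩S=∅ ∣Y∣≡∣Z∣))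
                  (≤-reflexive (1+∣p-x∣≡∣p∣ S a (Y⊆S a∈Y)))
    inside-Z : (∃ λ x → x ∈ (S ─ Y) ∪ Z × x ∉ S - a × I ((S - a) ∪ ⁅ x ⁆)) → ∃ λ b → b ∈ Z × I ((S - a) ∪ ⁅ b ⁆)
    inside-Z (x , x∈S─Y∪Z , x∉S-a , iS-a+x) with ∪⁻ x∈S─Y∪Z
    ... | inj₂ x∈Z   = x , x∈Z , iS-a+x
    ... | inj₁ x∈S─Y = ⊥-elim (x∉S-a (-⁺ (─ˡ x∈S─Y) (λ x≡a → ─ʳ x∈S─Y (subst (_∈ Y) (sym x≡a) a∈Y))))

  -- Extend (W ─ Y) ∪ Z by elements of X: since W spans Z, no element of Y can be added back.
  block-exchange : ∀ {X W Y Z} → I X → W ⊆ X → Y ⊆ W → (∀ {z} → z ∈ Z → z ∉ X) → ∣ Y ∣ ≡ ∣ Z ∣ →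
                   I ((W ─ Y) ∪ Z) → (∀ {z} → z ∈ Z → ¬ I (W ∪ ⁅ z ⁆)) → I ((X ─ Y) ∪ Z)
  block-exchange {X} {W} {Y} {Z} iX W⊆X Y⊆W Z∩X=∅ ∣Y∣≡∣Z∣ iQ W-spans-Z = indep-⊆ M R⊆Q′ indep
    where
    Q : Subset n
    Q = (W ─ Y) ∪ Z
    ∣Q∣ : ∣ Q ∣ ≡ ∣ W ∣
    ∣Q∣ = ∣[p─q]∪r∣≡∣p∣ W Y Z Y⊆W (λ z∈Z z∈W → Z∩X=∅ z∈Z (W⊆X z∈W)) ∣Y∣≡∣Z∣
    open Extension (extend iQ iX (subst (_≤ ∣ X ∣) (sym ∣Q∣) (p⊆q⇒∣p∣≤∣q∣ W⊆X))) renaming (set to Q′)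
    Y∩Q′=∅ : ∀ {y} → y ∈ Y → y ∉ Q′
    Y∩Q′=∅ {y} y∈Y y∈Q′ = <-irrefl refl (begin-strict
      ∣ W ∣             ≡⟨ sym ∣Q∣ ⟩
      ∣ Q ∣             <⟨ n<1+n ∣ Q ∣ ⟩
      suc ∣ Q ∣         ≡⟨ sym (∣p∪⁅x⁆∣≡1+∣p∣ Q y y∉Q) ⟩
      ∣ Q ∪ ⁅ y ⁆ ∣     ≤⟨ spanned⇒∣∣≤ (indep-⊆ M W⊆X iX) (indep-⊆ M (∪⁅⁆-⊆ ⊇Q y∈Q′) indep) W-spans ⟩
      ∣ W ∣             ∎)
      where
      open ≤-Reasoning
      y∉Q : y ∉ Q
      y∉Q h = [ (λ h′ → ─ʳ h′ y∈Y) , (λ h′ → Z∩X=∅ h′ (W⊆X (Y⊆W y∈Y))) ]′ (∪⁻ h)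
      W-spans : ∀ {x} → x ∈ Q ∪ ⁅ y ⁆ → x ∉ W → ¬ I (W ∪ ⁅ x ⁆)
      W-spans x∈ x∉W with ∪⁻ x∈
      ... | inj₂ x≡y = ⊥-elim (x∉W (subst (_∈ W) (sym (⁅⁆⁻ x≡y)) (Y⊆W y∈Y)))
      ... | inj₁ x∈Q = [ (λ h → ⊥-elim (x∉W (─ˡ h))) , W-spans-Z ]′ (∪⁻ x∈Q)
    R : Subset n
    R = (X ─ Y) ∪ Z
    Q′⊆R : Q′ ⊆ R
    Q′⊆R {x} h with ∪⁻ (⊆Q∪T h)
    ... | inj₂ x∈X = ∪ˡ (─⁺ x∈X (λ x∈Y → Y∩Q′=∅ x∈Y h))
    ... | inj₁ x∈Q = [ (λ h′ → ∪ˡ (─⁺ (W⊆X (─ˡ h′)) (─ʳ h′))) , ∪ʳ ]′ (∪⁻ x∈Q)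
    R⊆Q′ : R ⊆ Q′
    R⊆Q′ = ⊆∧∣∣≤⇒⊇ Q′ R Q′⊆R (≤-reflexive (trans (∣[p─q]∪r∣≡∣p∣ X Y Z (λ h → W⊆X (Y⊆W h)) Z∩X=∅ ∣Y∣≡∣Z∣) (sym card)))

module LayeredExchange {n : ℕ} (M : Matroid n) (S X₀ : Subset n) (Y Z : ℕ → Subset n) where
  open MatroidProperties M

  swapped : ℕ → Subset n
  swapped zero    = X₀
  swapped (suc i) = (swapped i ─ Y (suc i)) ∪ Z (suc i)

  kept : ℕ → Subset n
  kept zero    = S
  kept (suc i) = kept i ─ Y (suc i)

  AvoidsY : ℕ → Fin n → Set
  AvoidsY i x = ∀ j → 1 ≤ j → j ≤ i → x ∉ Y j

  private
    avoidsY-pred : ∀ {i x} → AvoidsY (suc i) x → AvoidsY i x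
    avoidsY-pred avoids j 1≤j j≤i = avoids j 1≤j (m≤n⇒m≤1+n j≤i)

  ∈swapped⁺ : ∀ i {x} → x ∈ X₀ → AvoidsY i x → x ∈ swapped i
  ∈swapped⁺ zero    x∈X₀ _      = x∈X₀
  ∈swapped⁺ (suc i) x∈X₀ avoids = ∪ˡ (─⁺ (∈swapped⁺ i x∈X₀ (avoidsY-pred avoids)) (avoids (suc i) (s≤s z≤n) ≤-refl))

  ∈swapped⁻ : ∀ i {x} → x ∈ swapped i → (x ∈ X₀ × AvoidsY i x) ⊎ (∃ λ j → 1 ≤ j × j ≤ i × x ∈ Z j)
  ∈swapped⁻ zero    h = inj₁ (h , λ { j (s≤s _) () })
  ∈swapped⁻ (suc i) h with ∪⁻ h
  ... | inj₂ x∈Z = inj₂ (suc i , s≤s z≤n , ≤-refl , x∈Z)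
  ... | inj₁ h′ with ∈swapped⁻ i (─ˡ h′)
  ...   | inj₂ (j , 1≤j , j≤i , x∈Z) = inj₂ (j , 1≤j , m≤n⇒m≤1+n j≤i , x∈Z)
  ...   | inj₁ (x∈X₀ , avoids)       = inj₁ (x∈X₀ , avoids′)
    where
    avoids′ : AvoidsY (suc i) _
    avoids′ j 1≤j j≤1+i with m≤n⇒m<n∨m≡n j≤1+i
    ... | inj₁ (s≤s j≤i) = avoids j 1≤j j≤i
    ... | inj₂ refl      = ─ʳ h′

  kept⊆S : ∀ i → kept i ⊆ S
  kept⊆S zero    h = h
  kept⊆S (suc i) h = kept⊆S i (─ˡ h)

  ∈kept⁺ : ∀ i {x} → x ∈ S → AvoidsY i x → x ∈ kept i
  ∈kept⁺ zero    x∈S _      = x∈S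
  ∈kept⁺ (suc i) x∈S avoids = ─⁺ (∈kept⁺ i x∈S (avoidsY-pred avoids)) (avoids (suc i) (s≤s z≤n) ≤-refl)

  ∉kept⁻ : ∀ i {x} → x ∈ S → x ∉ kept i → ∃ λ j → 1 ≤ j × j ≤ i × x ∈ Y j
  ∉kept⁻ zero    x∈S x∉kept = ⊥-elim (x∉kept x∈S)
  ∉kept⁻ (suc i) {x} x∈S x∉kept with x ∈? Y (suc i)
  ... | yes x∈Y = suc i , s≤s z≤n , ≤-refl , x∈Y
  ... | no  x∉Y with x ∈? kept i
  ...   | yes x∈kept = ⊥-elim (x∉kept (─⁺ x∈kept x∉Y))
  ...   | no  x∉kept′ with ∉kept⁻ i x∈S x∉kept′
  ...     | j , 1≤j , j≤i , x∈Y = j , 1≤j , m≤n⇒m≤1+n j≤i , x∈Y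

  record Conditions (r : ℕ) : Set where
    field
      indep-S      : Indep M S
      indep-X₀     : Indep M X₀
      S⊆X₀         : S ⊆ X₀
      Y⊆S          : ∀ i → 1 ≤ i → i ≤ r → Y i ⊆ S
      Z∩X₀=∅       : ∀ i {z} → 1 ≤ i → i ≤ r → z ∈ Z i → z ∉ X₀
      ∣Y∣≡∣Z∣      : ∀ i → 1 ≤ i → i ≤ r → ∣ Y i ∣ ≡ ∣ Z i ∣
      indep-swap   : ∀ i → 1 ≤ i → i ≤ r → Indep M ((S ─ Y i) ∪ Z i)
      no-shortcut₁ : ∀ i {z} → 1 ≤ i → i ≤ r → z ∈ Z i → ¬ Indep M (S ∪ ⁅ z ⁆)
      no-shortcut₂ : ∀ i j {z y} → 1 ≤ j → j < i → i ≤ r → z ∈ Z i → y ∈ Y j → ¬ Indep M ((S - y) ∪ ⁅ z ⁆)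
      Y-disjoint   : ∀ i j {y} → 1 ≤ i → i ≤ r → 1 ≤ j → j ≤ r → y ∈ Y i → y ∈ Y j → i ≡ j
      Z-disjoint   : ∀ i j {z} → 1 ≤ i → i ≤ r → 1 ≤ j → j ≤ r → z ∈ Z i → z ∈ Z j → i ≡ j

  module _ {r : ℕ} (C : Conditions r) where
    open Conditions C

    ∈swapped⁺ᶻ : ∀ i j {x} → 1 ≤ j → j ≤ i → i ≤ r → x ∈ Z j → x ∈ swapped i
    ∈swapped⁺ᶻ zero    j (s≤s _) () _ _
    ∈swapped⁺ᶻ (suc i) j {x} 1≤j j≤1+i 1+i≤r x∈Z with m≤n⇒m<n∨m≡n j≤1+i
    ... | inj₂ refl      = ∪ʳ x∈Z
    ... | inj₁ (s≤s j≤i) = ∪ˡ (─⁺ (∈swapped⁺ᶻ i j 1≤j j≤i (≤-trans (n≤1+n i) 1+i≤r) x∈Z)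
                                  (λ x∈Y → Z∩X₀=∅ j 1≤j (≤-trans j≤1+i 1+i≤r) x∈Z (S⊆X₀ (Y⊆S (suc i) (s≤s z≤n) 1+i≤r x∈Y))))

    record Invariant (i : ℕ) : Set where
      field
        indep       : Indep M (swapped i)
        kept⊆swapped : kept i ⊆ swapped i
        card        : ∣ swapped i ∣ ≡ ∣ X₀ ∣

    invariant : ∀ i → i ≤ r → Invariant i
    invariant zero    _     = record { indep = indep-X₀ ; kept⊆swapped = S⊆X₀ ; card = refl }
    invariant (suc i) 1+i≤r = record
      { indep = block-exchange indep kept⊆swapped Y⊆kept Z∩swapped=∅ (∣Y∣≡∣Z∣ (suc i) 1≤1+i 1+i≤r)
                  (indep-⊆ M (∪-mono (λ h → ─⁺ (kept⊆S i (─ˡ h)) (─ʳ h)) (λ h → h)) (indep-swap (suc i) 1≤1+i 1+i≤r))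
                  kept-spans-Z
      ; kept⊆swapped = λ h → ∪ˡ (─⁺ (kept⊆swapped (─ˡ h)) (─ʳ h))
      ; card = trans (∣[p─q]∪r∣≡∣p∣ (swapped i) (Y (suc i)) (Z (suc i)) (λ h → kept⊆swapped (Y⊆kept h))
                       Z∩swapped=∅ (∣Y∣≡∣Z∣ (suc i) 1≤1+i 1+i≤r))
                     card
      }
      where
      open Invariant (invariant i (≤-trans (n≤1+n i) 1+i≤r))
      1≤1+i : 1 ≤ suc i
      1≤1+i = s≤s z≤n
      earlier : ∀ {j} → j ≤ i → j ≤ r
      earlier j≤i = ≤-trans j≤i (≤-trans (n≤1+n i) 1+i≤r)
      Y⊆kept : Y (suc i) ⊆ kept i
      Y⊆kept y∈Y = ∈kept⁺ i (Y⊆S (suc i) 1≤1+i 1+i≤r y∈Y) λ j 1≤j j≤i y∈Yj →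
        <-irrefl (Y-disjoint j (suc i) 1≤j (earlier j≤i) 1≤1+i 1+i≤r y∈Yj y∈Y) (s≤s j≤i)
      Z∩swapped=∅ : ∀ {z} → z ∈ Z (suc i) → z ∉ swapped i
      Z∩swapped=∅ z∈Z z∈swapped with ∈swapped⁻ i z∈swapped
      ... | inj₁ (z∈X₀ , _)             = Z∩X₀=∅ (suc i) 1≤1+i 1+i≤r z∈Z z∈X₀
      ... | inj₂ (j , 1≤j , j≤i , z∈Zj) =
        <-irrefl (Z-disjoint j (suc i) 1≤j (earlier j≤i) 1≤1+i 1+i≤r z∈Zj z∈Z) (s≤s j≤i)
      kept-spans-Z : ∀ {z} → z ∈ Z (suc i) → ¬ Indep M (kept i ∪ ⁅ z ⁆)
      kept-spans-Z z∈Z = ¬indep-∪⁅⁆-restrict indep-S (λ z∈S → Z∩X₀=∅ (suc i) 1≤1+i 1+i≤r z∈Z (S⊆X₀ z∈S))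
        (no-shortcut₁ (suc i) 1≤1+i 1+i≤r z∈Z) (kept⊆S i) λ e∈S e∉kept →
          let (j , 1≤j , j≤i , e∈Y) = ∉kept⁻ i e∈S e∉kept
          in  no-shortcut₂ (suc i) j 1≤j (s≤s j≤i) 1+i≤r z∈Z e∈Y

update : ∀ {a} {A : Set a} → ℕ → A → (ℕ → A) → ℕ → A
update k v f i with i ≟ k
... | yes _ = v
... | no  _ = f i

module _ {a} {A : Set a} where

  update-elim : ∀ {p} (P : ℕ → A → Set p) k v f i → (i ≡ k → P i v) → (i ≢ k → P i (f i)) → P i (update k v f i)
  update-elim P k v f i Pv Pf with i ≟ k
  ... | yes i≡k = Pv i≡k
  ... | no  i≢k = Pf i≢k

  update-elim₂ : ∀ {p} (P : ℕ → A → A → Set p) k u v f g i → (i ≡ k → P i u v) → (i ≢ k → P i (f i) (g i)) →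
                 P i (update k u f i) (update k v g i)
  update-elim₂ P k u v f g i Puv Pfg with i ≟ k
  ... | yes i≡k = Puv i≡k
  ... | no  i≢k = Pfg i≢k

  update-≡ : ∀ k v (f : ℕ → A) → update k v f k ≡ v
  update-≡ k v f with k ≟ k
  ... | yes _   = refl
  ... | no  k≢k = ⊥-elim (k≢k refl)

  update-≢ : ∀ k v (f : ℕ → A) {i} → i ≢ k → update k v f i ≡ f i
  update-≢ k v f {i} i≢k with i ≟ k
  ... | yes i≡k = ⊥-elim (i≢k i≡k)
  ... | no  _   = refl

-- The conditions of an augmenting set that concern one matroid, with the distance conditions
-- weakened to the absence of shortcut arcs; unlike distances, these survive augmentation.
record HalfAugmenting {n} (M : Matroid n) (L : ℕ) (S : Subset n) (Z Y : ℕ → Subset n) : Set where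
  field
    indep        : Indep M S
    indep-source : Indep M (S ∪ Z 0)
    indep-swap   : ∀ i → 1 ≤ i → i ≤ L → Indep M ((S ─ Y i) ∪ Z i)
    no-shortcut₁ : ∀ i {z} → 1 ≤ i → i ≤ L → z ∈ Z i → ¬ Indep M (S ∪ ⁅ z ⁆)
    no-shortcut₂ : ∀ i j {z y} → 1 ≤ j → j < i → i ≤ L → z ∈ Z i → y ∈ Y j → ¬ Indep M ((S - y) ∪ ⁅ z ⁆)

record LayerShape {n} (L : ℕ) (S : Subset n) (Z Y : ℕ → Subset n) : Set where
  field
    Z∩S=∅      : ∀ i {x} → i ≤ L → x ∈ Z i → x ∉ S
    Y⊆S        : ∀ i {x} → 1 ≤ i → i ≤ L → x ∈ Y i → x ∈ S
    Z-disjoint : ∀ i j {x} → i ≤ L → j ≤ L → x ∈ Z i → x ∈ Z j → i ≡ j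
    Y-disjoint : ∀ i j {x} → 1 ≤ i → i ≤ L → 1 ≤ j → j ≤ L → x ∈ Y i → x ∈ Y j → i ≡ j
    ∣Y∣≡∣Z∣    : ∀ i → 1 ≤ i → i ≤ L → ∣ Y i ∣ ≡ ∣ Z i ∣

Among : ∀ {n} → ℕ → (ℕ → Fin n) → Fin n → Set
Among L z x = ∃ λ i → i ≤ L × x ≡ z i

Avoids : ∀ {n} → ℕ → (ℕ → Fin n) → Fin n → Set
Avoids L y x = ∀ i → 1 ≤ i → i ≤ L → x ≢ y i

-- S′ = S + z 0 − y 1 + z 1 − ⋯ − y L + z L, for a path whose arcs S − y i + z i are independent.
module Augmentation {n} {M : Matroid n} {L : ℕ} {S : Subset n} {Z Y : ℕ → Subset n}
         (H : HalfAugmenting M L S Z Y) (shape : LayerShape L S Z Y)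
         (z y : ℕ → Fin n)
         (z∈Z : ∀ i → i ≤ L → z i ∈ Z i)
         (y∈Y : ∀ i → 1 ≤ i → i ≤ L → y i ∈ Y i)
         (arc : ∀ i → 1 ≤ i → i ≤ L → Indep M ((S - y i) ∪ ⁅ z i ⁆))
         (S′ : Subset n)
         (∈S′⁻ : ∀ {x} → x ∈ S′ → (x ∈ S ⊎ Among L z x) × Avoids L y x)
         (∈S′⁺ : ∀ {x} → x ∈ S ⊎ Among L z x → Avoids L y x → x ∈ S′)
         where
  open MatroidProperties M
  open HalfAugmenting H
  open LayerShape shape

  Ẑ Ŷ : ℕ → Subset n
  Ẑ i = ⁅ z i ⁆
  Ŷ i = ⁅ y i ⁆

  X₁ : Subset n
  X₁ = S ∪ Ẑ 0

  conditions : ∀ X₀ (Ys Zs : ℕ → Subset n) r → r ≤ L → Indep M X₀ → S ⊆ X₀ → (∀ {x} → x ∈ X₀ → x ∈ S ⊎ x ∈ Z 0) →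
               (∀ i → 1 ≤ i → i ≤ r → Ys i ⊆ Y i) → (∀ i → 1 ≤ i → i ≤ r → Zs i ⊆ Z i) →
               (∀ i → 1 ≤ i → i ≤ r → ∣ Ys i ∣ ≡ ∣ Zs i ∣) → (∀ i → 1 ≤ i → i ≤ r → Indep M ((S ─ Ys i) ∪ Zs i)) →
               LayeredExchange.Conditions M S X₀ Ys Zs r
  conditions X₀ Ys Zs r r≤L iX₀ S⊆X₀ X₀⊆S∪Z₀ Ys⊆Y Zs⊆Z ∣Ys∣≡∣Zs∣ indep-swap′ = record
    { indep-S = indep ; indep-X₀ = iX₀ ; S⊆X₀ = S⊆X₀
    ; Y⊆S = λ i 1≤i i≤r h → Y⊆S i 1≤i (≤L i≤r) (Ys⊆Y i 1≤i i≤r h)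
    ; Z∩X₀=∅ = Zs∩X₀=∅
    ; ∣Y∣≡∣Z∣ = ∣Ys∣≡∣Zs∣ ; indep-swap = indep-swap′
    ; no-shortcut₁ = λ i 1≤i i≤r h → no-shortcut₁ i 1≤i (≤L i≤r) (Zs⊆Z i 1≤i i≤r h)
    ; no-shortcut₂ = λ i j 1≤j j<i i≤r hz hy →
        no-shortcut₂ i j 1≤j j<i (≤L i≤r) (Zs⊆Z i (≤-trans 1≤j (<⇒≤ j<i)) i≤r hz) (Ys⊆Y j 1≤j (≤-trans (<⇒≤ j<i) i≤r) hy)
    ; Y-disjoint = λ i j 1≤i i≤r 1≤j j≤r hi hj →
        Y-disjoint i j 1≤i (≤L i≤r) 1≤j (≤L j≤r) (Ys⊆Y i 1≤i i≤r hi) (Ys⊆Y j 1≤j j≤r hj)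
    ; Z-disjoint = λ i j 1≤i i≤r 1≤j j≤r hi hj →
        Z-disjoint i j (≤L i≤r) (≤L j≤r) (Zs⊆Z i 1≤i i≤r hi) (Zs⊆Z j 1≤j j≤r hj)
    }
    where
    ≤L : ∀ {i} → i ≤ r → i ≤ L
    ≤L i≤r = ≤-trans i≤r r≤L
    Zs∩X₀=∅ : ∀ i {x} → 1 ≤ i → i ≤ r → x ∈ Zs i → x ∉ X₀
    Zs∩X₀=∅ i 1≤i i≤r x∈Zs x∈X₀ with X₀⊆S∪Z₀ x∈X₀
    ... | inj₁ x∈S  = Z∩S=∅ i (≤L i≤r) (Zs⊆Z i 1≤i i≤r x∈Zs) x∈S
    ... | inj₂ x∈Z₀ with Z-disjoint i 0 (≤L i≤r) z≤n (Zs⊆Z i 1≤i i≤r x∈Zs) x∈Z₀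
    Zs∩X₀=∅ (suc i) 1≤i i≤r x∈Zs x∈X₀ | inj₂ x∈Z₀ | ()

  z∉S : ∀ i → i ≤ L → z i ∉ S
  z∉S i i≤L = Z∩S=∅ i i≤L (z∈Z i i≤L)

  y∈S : ∀ i → 1 ≤ i → i ≤ L → y i ∈ S
  y∈S i 1≤i i≤L = Y⊆S i 1≤i i≤L (y∈Y i 1≤i i≤L)

  z≢y : ∀ i j → i ≤ L → 1 ≤ j → j ≤ L → z i ≢ y j
  z≢y i j i≤L 1≤j j≤L z≡y = z∉S i i≤L (subst (_∈ S) (sym z≡y) (y∈S j 1≤j j≤L))

  ∣Ŷ∣≡∣Ẑ∣ : ∀ i → ∣ Ŷ i ∣ ≡ ∣ Ẑ i ∣
  ∣Ŷ∣≡∣Ẑ∣ i = trans (∣⁅x⁆∣≡1 (y i)) (sym (∣⁅x⁆∣≡1 (z i)))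

  module Path = LayeredExchange M S X₁ Ŷ Ẑ

  avoids⇒AvoidsŶ : ∀ {r x} → r ≤ L → Avoids L y x → Path.AvoidsY r x
  avoids⇒AvoidsŶ r≤L avoids j 1≤j j≤r x∈Ŷ = avoids j 1≤j (≤-trans j≤r r≤L) (⁅⁆⁻ x∈Ŷ)


  X₁⊆S∪Z₀ : ∀ {x} → x ∈ X₁ → x ∈ S ⊎ x ∈ Z 0
  X₁⊆S∪Z₀ h = [ inj₁ , (λ h′ → inj₂ (∈⁅⁆⇒⊆ (z∈Z 0 z≤n) h′)) ]′ (∪⁻ h)

  indep-X₁ : Indep M X₁
  indep-X₁ = indep-⊆ M (∪-mono (λ h → h) (∈⁅⁆⇒⊆ (z∈Z 0 z≤n))) indep-source

  ∣X₁∣ : ∣ X₁ ∣ ≡ suc ∣ S ∣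
  ∣X₁∣ = ∣p∪⁅x⁆∣≡1+∣p∣ S (z 0) (z∉S 0 z≤n)


  path-conditions : ∀ r → r ≤ L → Path.Conditions r
  path-conditions r r≤L = conditions X₁ Ŷ Ẑ r r≤L indep-X₁ ∪ˡ X₁⊆S∪Z₀
    (λ i 1≤i i≤r → ∈⁅⁆⇒⊆ (y∈Y i 1≤i (≤-trans i≤r r≤L))) (λ i _ i≤r → ∈⁅⁆⇒⊆ (z∈Z i (≤-trans i≤r r≤L)))
    (λ i _ _ → ∣Ŷ∣≡∣Ẑ∣ i) (λ i 1≤i i≤r → arc i 1≤i (≤-trans i≤r r≤L))

  path-invariant : ∀ r (r≤L : r ≤ L) → Path.Invariant (path-conditions r r≤L) r
  path-invariant r r≤L = Path.invariant (path-conditions r r≤L) r ≤-refl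

  S′⊆path : S′ ⊆ Path.swapped L
  S′⊆path h with ∈S′⁻ h
  ... | inj₁ x∈S                  , avoids = Path.∈swapped⁺ L (∪ˡ x∈S) (avoids⇒AvoidsŶ ≤-refl avoids)
  ... | inj₂ (zero  , _ , refl)   , avoids = Path.∈swapped⁺ L (∪ʳ (x∈⁅x⁆ _)) (avoids⇒AvoidsŶ ≤-refl avoids)
  ... | inj₂ (suc i , i≤L , refl) , _      = Path.∈swapped⁺ᶻ (path-conditions L ≤-refl) L (suc i) (s≤s z≤n) i≤L ≤-refl (x∈⁅x⁆ _)

  path⊆S′ : Path.swapped L ⊆ S′
  path⊆S′ h with Path.∈swapped⁻ L h
  ... | inj₂ (j , _ , j≤L , x∈Ẑ) rewrite ⁅⁆⁻ x∈Ẑ = ∈S′⁺ (inj₂ (j , j≤L , refl)) (λ i → z≢y j i j≤L)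
  ... | inj₁ (x∈X₁ , avoidsŶ) with ∪⁻ x∈X₁
  ...   | inj₁ x∈S = ∈S′⁺ (inj₁ x∈S) (λ i 1≤i i≤L x≡y → avoidsŶ i 1≤i i≤L (subst (_∈ Ŷ i) (sym x≡y) (x∈⁅x⁆ _)))
  ...   | inj₂ x∈Ẑ rewrite ⁅⁆⁻ x∈Ẑ = ∈S′⁺ (inj₂ (0 , z≤n , refl)) (λ i → z≢y 0 i z≤n)

  indep′ : Indep M S′
  indep′ = indep-⊆ M S′⊆path (Path.Invariant.indep (path-invariant L ≤-refl))

  ∣S′∣ : ∣ S′ ∣ ≡ suc ∣ S ∣
  ∣S′∣ = trans (≤-antisym (p⊆q⇒∣p∣≤∣q∣ S′⊆path) (p⊆q⇒∣p∣≤∣q∣ path⊆S′))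
               (trans (Path.Invariant.card (path-invariant L ≤-refl)) ∣X₁∣)

  module Source = LayeredExchange M S (S ∪ Z 0) Ŷ Ẑ

  indep-source′ : Indep M (S′ ∪ (Z 0 - z 0))
  indep-source′ = indep-⊆ M ⊆source (Source.Invariant.indep (Source.invariant source-conditions L ≤-refl))
    where
    source-conditions : Source.Conditions L
    source-conditions = conditions (S ∪ Z 0) Ŷ Ẑ L ≤-refl indep-source ∪ˡ ∪⁻
      (λ i 1≤i i≤L → ∈⁅⁆⇒⊆ (y∈Y i 1≤i i≤L)) (λ i _ i≤L → ∈⁅⁆⇒⊆ (z∈Z i i≤L)) (λ i _ _ → ∣Ŷ∣≡∣Ẑ∣ i) arc
    ⊆source : S′ ∪ (Z 0 - z 0) ⊆ Source.swapped L
    ⊆source h with ∪⁻ h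
    ... | inj₂ x∈Z₀-z₀ = Source.∈swapped⁺ L (∪ʳ (-ˡ x∈Z₀-z₀))
                           (λ j 1≤j j≤L x∈Ŷ → Z∩S=∅ 0 z≤n (-ˡ x∈Z₀-z₀) (subst (_∈ S) (sym (⁅⁆⁻ x∈Ŷ)) (y∈S j 1≤j j≤L)))
    ... | inj₁ x∈S′ with ∈S′⁻ x∈S′
    ...   | inj₁ x∈S                  , avoids = Source.∈swapped⁺ L (∪ˡ x∈S) (avoids⇒AvoidsŶ ≤-refl avoids)
    ...   | inj₂ (zero  , _ , refl)   , avoids = Source.∈swapped⁺ L (∪ʳ (z∈Z 0 z≤n)) (avoids⇒AvoidsŶ ≤-refl avoids)
    ...   | inj₂ (suc i , i≤L , refl) , _      = Source.∈swapped⁺ᶻ source-conditions L (suc i) (s≤s z≤n) i≤L ≤-refl (x∈⁅x⁆ _)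

  -- Layer k is exchanged as a whole, every other layer only along the path.
  module Swap (k : ℕ) (1≤k : 1 ≤ k) (k≤L : k ≤ L) where
    Ys Zs : ℕ → Subset n
    Ys = update k (Y k) Ŷ
    Zs = update k (Z k) Ẑ

    module Swapped = LayeredExchange M S X₁ Ys Zs

    swap-conditions : Swapped.Conditions L
    swap-conditions = conditions X₁ Ys Zs L ≤-refl indep-X₁ ∪ˡ X₁⊆S∪Z₀
      (λ i 1≤i i≤L → update-elim (λ i A → A ⊆ Y i) k (Y k) Ŷ i (λ { refl h → h }) (λ _ → ∈⁅⁆⇒⊆ (y∈Y i 1≤i i≤L)))
      (λ i _ i≤L → update-elim (λ i B → B ⊆ Z i) k (Z k) Ẑ i (λ { refl h → h }) (λ _ → ∈⁅⁆⇒⊆ (z∈Z i i≤L)))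
      (λ i _ _ → update-elim₂ (λ _ A B → ∣ A ∣ ≡ ∣ B ∣) k (Y k) (Z k) Ŷ Ẑ i (λ _ → ∣Y∣≡∣Z∣ k 1≤k k≤L) (λ _ → ∣Ŷ∣≡∣Ẑ∣ i))
      (λ i 1≤i i≤L → update-elim₂ (λ _ A B → Indep M ((S ─ A) ∪ B)) k (Y k) (Z k) Ŷ Ẑ i
                       (λ _ → indep-swap k 1≤k k≤L) (λ _ → arc i 1≤i i≤L))

    indep-swap′ : Indep M ((S′ ─ (Y k - y k)) ∪ (Z k - z k))
    indep-swap′ = indep-⊆ M ⊆swapped (Swapped.Invariant.indep (Swapped.invariant swap-conditions L ≤-refl))
      where
      avoidsYs : ∀ {x} → Avoids L y x → x ∉ Y k - y k → Swapped.AvoidsY L x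
      avoidsYs {x} avoids x∉Yk-yk j 1≤j j≤L x∈Ys = update-elim (λ j A → x ∉ A) k (Y k) Ŷ j
        (λ _ x∈Yk → x∉Yk-yk (-⁺ x∈Yk (avoids k 1≤k k≤L))) (λ _ x∈Ŷ → avoids j 1≤j j≤L (⁅⁆⁻ x∈Ŷ)) x∈Ys
      z∈swapped : ∀ i → 1 ≤ i → i ≤ L → z i ∈ Swapped.swapped L
      z∈swapped i 1≤i i≤L with i ≟ k
      ... | yes refl = Swapped.∈swapped⁺ᶻ swap-conditions L k 1≤k k≤L ≤-refl
                         (subst (z k ∈_) (sym (update-≡ k (Z k) Ẑ)) (z∈Z k k≤L))
      ... | no  i≢k  = Swapped.∈swapped⁺ᶻ swap-conditions L i 1≤i i≤L ≤-refl
                         (subst (z i ∈_) (sym (update-≢ k (Z k) Ẑ i≢k)) (x∈⁅x⁆ (z i)))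
      ⊆swapped : (S′ ─ (Y k - y k)) ∪ (Z k - z k) ⊆ Swapped.swapped L
      ⊆swapped h with ∪⁻ h
      ... | inj₂ x∈Zk-zk = Swapped.∈swapped⁺ᶻ swap-conditions L k 1≤k k≤L ≤-refl
                             (subst (_ ∈_) (sym (update-≡ k (Z k) Ẑ)) (-ˡ x∈Zk-zk))
      ... | inj₁ x∈S′─ with ∈S′⁻ (─ˡ x∈S′─)
      ...   | inj₁ x∈S                  , avoids = Swapped.∈swapped⁺ L (∪ˡ x∈S) (avoidsYs avoids (─ʳ x∈S′─))
      ...   | inj₂ (zero  , _ , refl)   , avoids = Swapped.∈swapped⁺ L (∪ʳ (x∈⁅x⁆ _)) (avoidsYs avoids (─ʳ x∈S′─))
      ...   | inj₂ (suc i , i≤L , refl) , _      = z∈swapped (suc i) (s≤s z≤n) i≤L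

  z∉S′ : ∀ i {x} → i ≤ L → x ∈ Z i - z i → x ∉ S′
  z∉S′ i i≤L x∈ x∈S′ with ∈S′⁻ x∈S′
  ... | inj₁ x∈S , _              = Z∩S=∅ i i≤L (-ˡ x∈) x∈S
  ... | inj₂ (m , m≤L , refl) , _ = -ʳ x∈ (cong z (Z-disjoint m i m≤L i≤L (z∈Z m m≤L) (-ˡ x∈)))

  ∣S′∪⁅x⁆∣ : ∀ i {x} → i ≤ L → x ∈ Z i - z i → ∣ S′ ∪ ⁅ x ⁆ ∣ ≡ suc (suc ∣ S ∣)
  ∣S′∪⁅x⁆∣ i {x} i≤L x∈ = trans (∣p∪⁅x⁆∣≡1+∣p∣ S′ x (z∉S′ i i≤L x∈)) (cong suc ∣S′∣)

  -- S′ + x lies in the span of X₁, which is one element too small to contain it independently.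
  no-shortcut₁′ : ∀ i {x} → 1 ≤ i → i ≤ L → x ∈ Z i - z i → ¬ Indep M (S′ ∪ ⁅ x ⁆)
  no-shortcut₁′ i {x} 1≤i i≤L x∈ iS′+x = 1+n≰n (begin
    suc (suc ∣ S ∣) ≡⟨ sym (∣S′∪⁅x⁆∣ i i≤L x∈) ⟩
    ∣ S′ ∪ ⁅ x ⁆ ∣  ≤⟨ spanned⇒∣∣≤ indep-X₁ iS′+x X₁-spans ⟩
    ∣ X₁ ∣          ≡⟨ ∣X₁∣ ⟩
    suc ∣ S ∣       ∎)
    where
    open ≤-Reasoning
    X₁-spans-Z : ∀ m {v} → 1 ≤ m → m ≤ L → v ∈ Z m → ¬ Indep M (X₁ ∪ ⁅ v ⁆)
    X₁-spans-Z m 1≤m m≤L v∈Z iX₁+v = no-shortcut₁ m 1≤m m≤L v∈Z (indep-⊆ M (∪-mono ∪ˡ (λ h → h)) iX₁+v)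
    X₁-spans : ∀ {v} → v ∈ S′ ∪ ⁅ x ⁆ → v ∉ X₁ → ¬ Indep M (X₁ ∪ ⁅ v ⁆)
    X₁-spans v∈ v∉X₁ with ∪⁻ v∈
    ... | inj₂ v∈⁅x⁆ rewrite ⁅⁆⁻ v∈⁅x⁆ = X₁-spans-Z i 1≤i i≤L (-ˡ x∈)
    ... | inj₁ v∈S′ with ∈S′⁻ v∈S′
    ...   | inj₁ v∈S                  , _ = ⊥-elim (v∉X₁ (∪ˡ v∈S))
    ...   | inj₂ (zero  , _ , refl)   , _ = ⊥-elim (v∉X₁ (∪ʳ (x∈⁅x⁆ _)))
    ...   | inj₂ (suc m , m≤L , refl) , _ = X₁-spans-Z (suc m) (s≤s z≤n) m≤L (z∈Z (suc m) m≤L)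

  -- For u ∈ Y j − y j, the set X = swapped j − u has ∣ S ∣ elements and spans all of S′ − u + x.
  module Stage (j : ℕ) (1≤j : 1 ≤ j) (j≤L : j ≤ L) {u : Fin n} (u∈ : u ∈ Y j - y j) where
    open Path.Invariant (path-invariant j j≤L) using (kept⊆swapped; card)

    X : Subset n
    X = Path.swapped j - u

    u∈S : u ∈ S
    u∈S = Y⊆S j 1≤j j≤L (-ˡ u∈)

    u-avoids : Avoids L y u
    u-avoids m 1≤m m≤L u≡y = -ʳ u∈ (trans u≡y (cong y (Y-disjoint m j 1≤m m≤L 1≤j j≤L
                                                   (subst (_∈ Y m) (sym u≡y) (y∈Y m 1≤m m≤L)) (-ˡ u∈))))

    ∣X∣ : ∣ X ∣ ≡ ∣ S ∣
    ∣X∣ = suc-injective (trans (1+∣p-x∣≡∣p∣ _ u (Path.∈swapped⁺ j (∪ˡ u∈S) (avoids⇒AvoidsŶ j≤L u-avoids)))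
                               (trans card ∣X₁∣))

    ∈X⁺ : ∀ {v} → v ∈ S′ - u → Among j z v ⊎ v ∈ S → v ∈ X
    ∈X⁺ {v} v∈ (inj₁ (zero , _ , refl)) = -⁺ (Path.∈swapped⁺ j (∪ʳ (x∈⁅x⁆ _)) (avoids⇒AvoidsŶ j≤L (proj₂ (∈S′⁻ (-ˡ v∈))))) (-ʳ v∈)
    ∈X⁺ {v} v∈ (inj₁ (suc m , 1+m≤j , refl)) = -⁺ (Path.∈swapped⁺ᶻ (path-conditions j j≤L) j (suc m) (s≤s z≤n) 1+m≤j ≤-refl (x∈⁅x⁆ _)) (-ʳ v∈)
    ∈X⁺ {v} v∈ (inj₂ v∈S) = -⁺ (Path.∈swapped⁺ j (∪ˡ v∈S) (avoids⇒AvoidsŶ j≤L (proj₂ (∈S′⁻ (-ˡ v∈))))) (-ʳ v∈)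

    X-spans-later : ∀ m {v} → j < m → m ≤ L → v ∈ Z m → ¬ Indep M (X ∪ ⁅ v ⁆)
    X-spans-later m {v} j<m m≤L v∈Z iX+v =
      ¬indep-∪⁅⁆-restrict indep (Z∩S=∅ m m≤L v∈Z) (no-shortcut₁ m (≤-trans 1≤j (<⇒≤ j<m)) m≤L v∈Z) W⊆S unexchangeable
        (indep-⊆ M (∪-mono W⊆X (λ h → h)) iX+v)
      where
      W : Subset n
      W = Path.kept j - u
      W⊆S : W ⊆ S
      W⊆S h = Path.kept⊆S j (-ˡ h)
      W⊆X : W ⊆ X
      W⊆X h = -⁺ (kept⊆swapped (-ˡ h)) (-ʳ h)
      unexchangeable : ∀ {e} → e ∈ S → e ∉ W → ¬ Indep M ((S - e) ∪ ⁅ v ⁆)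
      unexchangeable {e} e∈S e∉W with e ∈? Path.kept j
      ... | no e∉kept =
        let (j′ , 1≤j′ , j′≤j , e∈Ŷ) = Path.∉kept⁻ j e∈S e∉kept
        in  no-shortcut₂ m j′ 1≤j′ (≤-<-trans j′≤j j<m) m≤L v∈Z
              (subst (_∈ Y j′) (sym (⁅⁆⁻ e∈Ŷ)) (y∈Y j′ 1≤j′ (≤-trans j′≤j j≤L)))
      ... | yes e∈kept with e Data.Fin.≟ u
      ...   | yes refl = no-shortcut₂ m j 1≤j j<m m≤L v∈Z (-ˡ u∈)
      ...   | no  e≢u  = ⊥-elim (e∉W (-⁺ e∈kept e≢u))

  no-shortcut₂′ : ∀ i j {x u} → 1 ≤ j → j < i → i ≤ L → x ∈ Z i - z i → u ∈ Y j - y j → ¬ Indep M ((S′ - u) ∪ ⁅ x ⁆)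
  no-shortcut₂′ i j {x} {u} 1≤j j<i i≤L x∈ u∈ iS′-u+x = 1+n≰n (begin
    suc ∣ S ∣             ≡⟨ sym (suc-injective (trans ∣S′-u+x∣ (∣S′∪⁅x⁆∣ i i≤L x∈))) ⟩
    ∣ (S′ - u) ∪ ⁅ x ⁆ ∣  ≤⟨ spanned⇒∣∣≤ (indep-⊆ M -ˡ (Path.Invariant.indep (path-invariant j j≤L))) iS′-u+x X-spans ⟩
    ∣ X ∣                 ≡⟨ ∣X∣ ⟩
    ∣ S ∣                 ∎)
    where
    open ≤-Reasoning
    j≤L : j ≤ L
    j≤L = ≤-trans (<⇒≤ j<i) i≤L
    open Stage j 1≤j j≤L u∈
    ∣S′-u+x∣ : suc ∣ (S′ - u) ∪ ⁅ x ⁆ ∣ ≡ ∣ S′ ∪ ⁅ x ⁆ ∣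
    ∣S′-u+x∣ = begin-equality
      suc ∣ (S′ - u) ∪ ⁅ x ⁆ ∣ ≡⟨ cong suc (∣p∪⁅x⁆∣≡1+∣p∣ (S′ - u) x (λ h → z∉S′ i i≤L x∈ (-ˡ h))) ⟩
      suc (suc ∣ S′ - u ∣)     ≡⟨ cong suc (1+∣p-x∣≡∣p∣ S′ u (∈S′⁺ (inj₁ u∈S) u-avoids)) ⟩
      suc ∣ S′ ∣               ≡⟨ sym (∣p∪⁅x⁆∣≡1+∣p∣ S′ x (z∉S′ i i≤L x∈)) ⟩
      ∣ S′ ∪ ⁅ x ⁆ ∣           ∎
    X-spans : ∀ {v} → v ∈ (S′ - u) ∪ ⁅ x ⁆ → v ∉ X → ¬ Indep M (X ∪ ⁅ v ⁆)
    X-spans v∈ v∉X with ∪⁻ v∈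
    ... | inj₂ v∈⁅x⁆ rewrite ⁅⁆⁻ v∈⁅x⁆ = X-spans-later i j<i i≤L (-ˡ x∈)
    ... | inj₁ v∈S′-u with ∈S′⁻ (-ˡ v∈S′-u)
    ...   | inj₁ v∈S , _ = ⊥-elim (v∉X (∈X⁺ v∈S′-u (inj₂ v∈S)))
    ...   | inj₂ (m , m≤L , refl) , _ with m ≤? j
    ...     | yes m≤j = ⊥-elim (v∉X (∈X⁺ v∈S′-u (inj₁ (m , m≤j , refl))))
    ...     | no  m≰j = X-spans-later m (≰⇒> m≰j) m≤L (z∈Z m m≤L)

  half-augmenting : HalfAugmenting M L S′ (λ i → Z i - z i) (λ i → Y i - y i)
  half-augmenting = record
    { indep = indep′ ; indep-source = indep-source′ ; indep-swap = λ k 1≤k k≤L → Swap.indep-swap′ k 1≤k k≤L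
    ; no-shortcut₁ = no-shortcut₁′ ; no-shortcut₂ = no-shortcut₂′ }

flips : ℕ → Bool → Bool
flips zero    b = b
flips (suc k) b = not (flips k b)

flips-not : ∀ k b → flips k (not b) ≡ not (flips k b)
flips-not zero    b = refl
flips-not (suc k) b = cong not (flips-not k b)

flips-+ : ∀ j k b → flips (j + k) b ≡ flips j (flips k b)
flips-+ zero    k b = refl
flips-+ (suc j) k b = cong not (flips-+ j k b)

flips-flips : ∀ k b → flips k (flips k b) ≡ b
flips-flips zero    b = refl
flips-flips (suc k) b = begin
  not (flips k (not (flips k b))) ≡⟨ cong not (flips-not k (flips k b)) ⟩
  not (not (flips k (flips k b))) ≡⟨ not-involutive _ ⟩
  flips k (flips k b)             ≡⟨ flips-flips k b ⟩
  b                               ∎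
  where open ≡-Reasoning

flips-even : ∀ m b → flips (2 * m) b ≡ b
flips-even m b = begin
  flips (m + (m + 0)) b     ≡⟨ flips-+ m (m + 0) b ⟩
  flips m (flips (m + 0) b) ≡⟨ cong (λ k → flips m (flips k b)) (+-identityʳ m) ⟩
  flips m (flips m b)       ≡⟨ flips-flips m b ⟩
  b                         ∎
  where open ≡-Reasoning

module ExchangeGraph {n : ℕ} (M₁ M₂ : Matroid n) (S : Subset n) where

  -- Every arc of G(S) between elements joins S to its complement, and s lies on the side of S.
  side : Node n → Bool
  side s      = true
  side t      = false
  side (el x) = does (x ∈? S)

  side-el⇒∈ : ∀ {x} → side (el x) ≡ true → x ∈ S
  side-el⇒∈ {x} eq with x ∈? S
  ... | yes x∈S = x∈S

  side-el⇒∉ : ∀ {x} → side (el x) ≡ false → x ∉ S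
  side-el⇒∉ {x} eq with x ∈? S
  ... | no x∉S = x∉S

  arc-flips-side : ∀ {u v} → Arc M₁ M₂ S u (el v) → side (el v) ≡ not (side u)
  arc-flips-side (arc-s {a} a∉S _)           = dec-false (a ∈? S) a∉S
  arc-flips-side (arc-ab {a} {b} a∈S b∉S _) = trans (dec-false (b ∈? S) b∉S) (cong not (sym (dec-true (a ∈? S) a∈S)))
  arc-flips-side (arc-ba {a} {b} a∈S b∉S _) = trans (dec-true (a ∈? S) a∈S) (cong not (sym (dec-false (b ∈? S) b∉S)))

  walk-flips-side : ∀ {u v k} → Walk M₁ M₂ S u (el v) k → side (el v) ≡ flips k (side u)
  walk-flips-side []                                = refl
  walk-flips-side (_∷_ {v = s} () _)
  walk-flips-side (_∷_ {v = t} _ (() ∷ _))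
  walk-flips-side {v = v} (_∷_ {u = u} {v = el x} {k = k} a w) = begin
    side (el v)               ≡⟨ walk-flips-side w ⟩
    flips k (side (el x))     ≡⟨ cong (flips k) (arc-flips-side a) ⟩
    flips k (not (side u))    ≡⟨ flips-not k (side u) ⟩
    not (flips k (side u))    ∎
    where open ≡-Reasoning

  _∷ʳ_ : ∀ {u v x k} → Walk M₁ M₂ S u v k → Arc M₁ M₂ S v x → Walk M₁ M₂ S u x (suc k)
  []      ∷ʳ a = a ∷ []
  (b ∷ w) ∷ʳ a = b ∷ (w ∷ʳ a)

  odd-walk⇒∉ : ∀ {x} m → Walk M₁ M₂ S s (el x) (suc (2 * m)) → x ∉ S
  odd-walk⇒∉ m w = side-el⇒∉ (trans (walk-flips-side w) (cong not (flips-even m true)))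

  even-walk⇒∈ : ∀ {x} m → Walk M₁ M₂ S s (el x) (2 * m) → x ∈ S
  even-walk⇒∈ m w = side-el⇒∈ (trans (walk-flips-side w) (flips-even m true))

  InD-unique : ∀ {x i j} → InD M₁ M₂ S i x → InD M₁ M₂ S j x → i ≡ j
  InD-unique (wi , i-min) (wj , j-min) = ≤-antisym (i-min _ wj) (j-min _ wi)

  ¬shorter-walk : ∀ {d k v} → DistFromS M₁ M₂ S v d → Walk M₁ M₂ S s v k → k < d → ⊥
  ¬shorter-walk (_ , d-min) walk k<d = <⇒≱ k<d (d-min _ walk)

indexOr : ∀ {L} {X : Set} → X → (Fin L → X) → ℕ → X
indexOr {zero}  d f _       = d
indexOr {suc L} d f zero    = f zero
indexOr {suc L} d f (suc i) = indexOr d (λ k → f (suc k)) i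

indexOr-toℕ : ∀ {L} {X : Set} d (f : Fin L → X) k → indexOr d f (toℕ k) ≡ f k
indexOr-toℕ d f zero    = refl
indexOr-toℕ d f (suc k) = indexOr-toℕ d (λ k → f (suc k)) k

indexOr-elim : ∀ {L} {X : Set} (P : ℕ → X → Set) d (f : Fin L → X) →
               (∀ k → P (toℕ k) (f k)) → ∀ i → i < L → P i (indexOr d f i)
indexOr-elim P d f Pf i i<L = subst (λ m → P m (indexOr d f m)) (toℕ-fromℕ< i<L)
  (subst (P (toℕ (fromℕ< i<L))) (sym (indexOr-toℕ d f (fromℕ< i<L))) (Pf (fromℕ< i<L)))

module Augmenting {n : ℕ} (M₁ M₂ : Matroid n) (ℓ : ℕ) where

  record Shape (S : Subset n) (B A : ℕ → Subset n) (w : ℕ) : Set where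
    field
      B∩S=∅      : ∀ i {x} → i ≤ ℓ → x ∈ B i → x ∉ S
      A⊆S        : ∀ i {x} → i < ℓ → x ∈ A i → x ∈ S
      B-disjoint : ∀ i j {x} → i ≤ ℓ → j ≤ ℓ → x ∈ B i → x ∈ B j → i ≡ j
      A-disjoint : ∀ i j {x} → i < ℓ → j < ℓ → x ∈ A i → x ∈ A j → i ≡ j
      ∣B∣        : ∀ i → i ≤ ℓ → ∣ B i ∣ ≡ w
      ∣A∣        : ∀ i → i < ℓ → ∣ A i ∣ ≡ w

  -- M₁ reads the layers B 0, A 0, B 1, …, B ℓ forwards, M₂ reads them backwards from B ℓ.
  record Invariant (S : Subset n) (B A : ℕ → Subset n) (w : ℕ) : Set where
    field
      shape : Shape S B A w
      half₁ : HalfAugmenting M₁ ℓ S B (λ i → A (pred i))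
      half₂ : HalfAugmenting M₂ ℓ S (λ i → B (ℓ ∸ i)) (λ i → A (ℓ ∸ i))

  private
    pred< : ∀ {i} → 1 ≤ i → i ≤ ℓ → pred i < ℓ
    pred< (s≤s _) i≤ℓ = i≤ℓ

    ℓ∸<ℓ : ∀ {i} → 1 ≤ i → i ≤ ℓ → ℓ ∸ i < ℓ
    ℓ∸<ℓ 1≤i i≤ℓ = ∸-monoʳ-< 1≤i i≤ℓ

  module _ {S : Subset n} {B A : ℕ → Subset n} {w : ℕ} (shape : Shape S B A w) where
    open Shape shape

    layers₁ : LayerShape ℓ S B (λ i → A (pred i))
    layers₁ = record
      { Z∩S=∅      = B∩S=∅
      ; Y⊆S        = λ i 1≤i i≤ℓ → A⊆S (pred i) (pred< 1≤i i≤ℓ)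
      ; Z-disjoint = B-disjoint
      ; Y-disjoint = λ i j 1≤i i≤ℓ 1≤j j≤ℓ x∈ x∈′ →
          pred-injective ⦃ >-nonZero 1≤i ⦄ ⦃ >-nonZero 1≤j ⦄ (A-disjoint (pred i) (pred j) (pred< 1≤i i≤ℓ) (pred< 1≤j j≤ℓ) x∈ x∈′)
      ; ∣Y∣≡∣Z∣    = λ i 1≤i i≤ℓ → trans (∣A∣ (pred i) (pred< 1≤i i≤ℓ)) (sym (∣B∣ i i≤ℓ))
      }

    layers₂ : LayerShape ℓ S (λ i → B (ℓ ∸ i)) (λ i → A (ℓ ∸ i))
    layers₂ = record
      { Z∩S=∅      = λ i _ → B∩S=∅ (ℓ ∸ i) (m∸n≤m ℓ i)
      ; Y⊆S        = λ i 1≤i i≤ℓ → A⊆S (ℓ ∸ i) (ℓ∸<ℓ 1≤i i≤ℓ)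
      ; Z-disjoint = λ i j i≤ℓ j≤ℓ x∈ x∈′ →
          ∸-cancelˡ-≡ i≤ℓ j≤ℓ (B-disjoint (ℓ ∸ i) (ℓ ∸ j) (m∸n≤m ℓ i) (m∸n≤m ℓ j) x∈ x∈′)
      ; Y-disjoint = λ i j 1≤i i≤ℓ 1≤j j≤ℓ x∈ x∈′ →
          ∸-cancelˡ-≡ i≤ℓ j≤ℓ (A-disjoint (ℓ ∸ i) (ℓ ∸ j) (ℓ∸<ℓ 1≤i i≤ℓ) (ℓ∸<ℓ 1≤j j≤ℓ) x∈ x∈′)
      ; ∣Y∣≡∣Z∣    = λ i 1≤i i≤ℓ → trans (∣A∣ (ℓ ∸ i) (ℓ∸<ℓ 1≤i i≤ℓ)) (sym (∣B∣ (ℓ ∸ i) (m∸n≤m ℓ i)))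
      }

  module Step {S : Subset n} {B A : ℕ → Subset n} {w : ℕ} (inv : Invariant S B A (suc w)) where
    open Invariant inv
    open Shape shape

    indep-swap₁ : ∀ k → k < ℓ → Indep M₁ ((S ─ A k) ∪ B (suc k))
    indep-swap₁ k k<ℓ = HalfAugmenting.indep-swap half₁ (suc k) (s≤s z≤n) k<ℓ

    indep-swap₂ : ∀ k → k < ℓ → Indep M₂ ((S ─ A k) ∪ B k)
    indep-swap₂ k k<ℓ = subst (λ m → Indep M₂ ((S ─ A m) ∪ B m)) (m∸[m∸n]≡n (<⇒≤ k<ℓ))
                          (HalfAugmenting.indep-swap half₂ (ℓ ∸ k) (m<n⇒0<n∸m k<ℓ) (m∸n≤m ℓ k))

    record PathFrom (k : ℕ) (b₀ : Fin n) : Set where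
      field
        b a     : ℕ → Fin n
        b-start : b k ≡ b₀
        b∈B     : ∀ i → k ≤ i → i ≤ ℓ → b i ∈ B i
        a∈A     : ∀ i → k ≤ i → i < ℓ → a i ∈ A i
        arc₂    : ∀ i → k ≤ i → i < ℓ → Indep M₂ ((S - a i) ∪ ⁅ b i ⁆)
        arc₁    : ∀ i → k ≤ i → i < ℓ → Indep M₁ ((S - a i) ∪ ⁅ b (suc i) ⁆)

    cons-step : ∀ {k b₀ a₀ b₁} → b₀ ∈ B k → a₀ ∈ A k → Indep M₂ ((S - a₀) ∪ ⁅ b₀ ⁆) →
                Indep M₁ ((S - a₀) ∪ ⁅ b₁ ⁆) → PathFrom (suc k) b₁ → PathFrom k b₀
    cons-step {k} {b₀} {a₀} {b₁} b₀∈B a₀∈A arc₂₀ arc₁₀ R = record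
      { b = b′ ; a = a′ ; b-start = update-≡ k b₀ R.b
      ; b∈B  = λ i k≤i i≤ℓ → update-elim (λ i x → x ∈ B i) k b₀ R.b i (λ { refl → b₀∈B })
                               (λ i≢k → R.b∈B i (later k≤i i≢k) i≤ℓ)
      ; a∈A  = λ i k≤i i<ℓ → update-elim (λ i x → x ∈ A i) k a₀ R.a i (λ { refl → a₀∈A })
                               (λ i≢k → R.a∈A i (later k≤i i≢k) i<ℓ)
      ; arc₂ = λ i k≤i i<ℓ → update-elim₂ (λ _ x y → Indep M₂ ((S - x) ∪ ⁅ y ⁆)) k a₀ b₀ R.a R.b i
                               (λ _ → arc₂₀) (λ i≢k → R.arc₂ i (later k≤i i≢k) i<ℓ)
      ; arc₁ = arc₁′ }
      where
      module R = PathFrom R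
      later : ∀ {i} → k ≤ i → i ≢ k → suc k ≤ i
      later k≤i i≢k = ≤∧≢⇒< k≤i (λ k≡i → i≢k (sym k≡i))
      b′ a′ : ℕ → Fin n
      b′ = update k b₀ R.b
      a′ = update k a₀ R.a
      arc₁′ : ∀ i → k ≤ i → i < ℓ → Indep M₁ ((S - a′ i) ∪ ⁅ b′ (suc i) ⁆)
      arc₁′ i k≤i i<ℓ = subst (λ x → Indep M₁ ((S - a′ i) ∪ ⁅ x ⁆))
        (sym (update-≢ k b₀ R.b (λ 1+i≡k → 1+n≰n (≤-trans (≤-reflexive 1+i≡k) k≤i))))
        (update-elim (λ i x → Indep M₁ ((S - x) ∪ ⁅ R.b (suc i) ⁆)) k a₀ R.a i
          (λ { refl → subst (λ x → Indep M₁ ((S - a₀) ∪ ⁅ x ⁆)) (sym R.b-start) arc₁₀ })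
          (λ i≢k → R.arc₁ i (later k≤i i≢k) i<ℓ))

    path-from : ∀ r k → r + k ≡ ℓ → ∀ b₀ → b₀ ∈ B k → PathFrom k b₀
    path-from zero k refl b₀ b₀∈B = record
      { b = λ _ → b₀ ; a = λ _ → b₀ ; b-start = refl
      ; b∈B  = λ i k≤i i≤k → subst (λ m → b₀ ∈ B m) (≤-antisym k≤i i≤k) b₀∈B
      ; a∈A  = λ i k≤i i<k → ⊥-elim (<⇒≱ i<k k≤i)
      ; arc₂ = λ i k≤i i<k → ⊥-elim (<⇒≱ i<k k≤i)
      ; arc₁ = λ i k≤i i<k → ⊥-elim (<⇒≱ i<k k≤i) }
    path-from (suc r) k 1+r+k≡ℓ b₀ b₀∈B =
      step₂ (MatroidProperties.exchange-into-block M₂ (HalfAugmenting.indep half₂) (indep-swap₂ k k<ℓ) b₀∈B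
               (B∩S=∅ k (<⇒≤ k<ℓ) b₀∈B) (A⊆S k k<ℓ) (subst (1 ≤_) (sym (∣A∣ k k<ℓ)) (s≤s z≤n)))
      where
      k<ℓ : k < ℓ
      k<ℓ = subst (k <_) 1+r+k≡ℓ (s≤s (m≤n+m k r))
      step₂ : (∃ λ a₀ → a₀ ∈ A k × Indep M₂ ((S - a₀) ∪ ⁅ b₀ ⁆)) → PathFrom k b₀
      step₂ (a₀ , a₀∈A , arc₂₀) =
        step₁ (MatroidProperties.exchange-out-of-block M₁ (HalfAugmenting.indep half₁) (indep-swap₁ k k<ℓ) a₀∈A
                 (A⊆S k k<ℓ) (B∩S=∅ (suc k) k<ℓ) (trans (∣A∣ k k<ℓ) (sym (∣B∣ (suc k) k<ℓ))))
        where
        step₁ : (∃ λ b₁ → b₁ ∈ B (suc k) × Indep M₁ ((S - a₀) ∪ ⁅ b₁ ⁆)) → PathFrom k b₀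
        step₁ (b₁ , b₁∈B , arc₁₀) =
          cons-step b₀∈B a₀∈A arc₂₀ arc₁₀ (path-from r (suc k) (trans (+-suc r k) 1+r+k≡ℓ) b₁ b₁∈B)

    module Route {b₀ : Fin n} (P : PathFrom 0 b₀) where
      open PathFrom P

      b∉S : ∀ i → i ≤ ℓ → b i ∉ S
      b∉S i i≤ℓ = B∩S=∅ i i≤ℓ (b∈B i z≤n i≤ℓ)

      a∈S : ∀ i → i < ℓ → a i ∈ S
      a∈S i i<ℓ = A⊆S i i<ℓ (a∈A i z≤n i<ℓ)

      b≢a : ∀ i j → i ≤ ℓ → j < ℓ → b i ≢ a j
      b≢a i j i≤ℓ j<ℓ b≡a = b∉S i i≤ℓ (subst (_∈ S) (sym b≡a) (a∈S j j<ℓ))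

      a-injective : ∀ i j → i < ℓ → j < ℓ → a i ≡ a j → i ≡ j
      a-injective i j i<ℓ j<ℓ a≡a = A-disjoint i j i<ℓ j<ℓ (a∈A i z≤n i<ℓ) (subst (_∈ A j) (sym a≡a) (a∈A j z≤n j<ℓ))

      b-injective : ∀ i j → i ≤ ℓ → j ≤ ℓ → b i ≡ b j → i ≡ j
      b-injective i j i≤ℓ j≤ℓ b≡b = B-disjoint i j i≤ℓ j≤ℓ (b∈B i z≤n i≤ℓ) (subst (_∈ B j) (sym b≡b) (b∈B j z≤n j≤ℓ))

      rest : ℕ → ℕ → List (Fin n)
      rest k zero    = []
      rest k (suc r) = a k ∷ b (suc k) ∷ rest (suc k) r

      path : List (Fin n)
      path = b 0 ∷ rest 0 ℓ

      length-rest : ∀ k r → length (rest k r) ≡ r + r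
      length-rest k zero    = refl
      length-rest k (suc r) = cong suc (trans (cong suc (length-rest (suc k) r)) (sym (+-suc r r)))

      length-path : suc (length path) ≡ 2 * suc ℓ
      length-path = cong suc (trans (cong suc (length-rest 0 ℓ))
                      (trans (sym (+-suc ℓ ℓ)) (cong (λ m → ℓ + suc m) (sym (+-identityʳ ℓ)))))

      private
        <ℓ : ∀ {k r} → k + suc r ≡ ℓ → k < ℓ
        <ℓ {k} k+1+r≡ℓ = subst (k <_) k+1+r≡ℓ (m<m+n k (s≤s z≤n))

        next : ∀ {k r} → k + suc r ≡ ℓ → suc k + r ≡ ℓ
        next {k} {r} k+1+r≡ℓ = trans (sym (+-suc k r)) k+1+r≡ℓ

      chain : ∀ r k → k + r ≡ ℓ → ArcChain M₁ M₂ S (el (b k)) (rest k r)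
      chain zero k k+0≡ℓ = end (arc-t (b∉S k k≤ℓ) (indep-⊆ M₂ (∪-mono (λ h → h) (∈⁅⁆⇒⊆ bk∈Bℓ))
                                                     (HalfAugmenting.indep-source half₂)))
        where
        k≡ℓ : k ≡ ℓ
        k≡ℓ = trans (sym (+-identityʳ k)) k+0≡ℓ
        k≤ℓ : k ≤ ℓ
        k≤ℓ = ≤-reflexive k≡ℓ
        bk∈Bℓ : b k ∈ B ℓ
        bk∈Bℓ = subst (λ m → b k ∈ B m) k≡ℓ (b∈B k z≤n k≤ℓ)
      chain (suc r) k k+1+r≡ℓ =
        step (arc-ba (a∈S k k<ℓ) (b∉S k (<⇒≤ k<ℓ)) (arc₂ k z≤n k<ℓ))
          (step (arc-ab (a∈S k k<ℓ) (b∉S (suc k) k<ℓ) (arc₁ k z≤n k<ℓ))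
            (chain r (suc k) (next k+1+r≡ℓ)))
        where
        k<ℓ : k < ℓ
        k<ℓ = <ℓ k+1+r≡ℓ

      All-rest : ∀ (Q : Fin n → Set) r k → k + r ≡ ℓ → (∀ i → k ≤ i → i < ℓ → Q (a i)) →
                 (∀ i → k < i → i ≤ ℓ → Q (b i)) → All Q (rest k r)
      All-rest Q zero    k _       _  _  = []
      All-rest Q (suc r) k k+1+r≡ℓ Qa Qb =
        Qa k ≤-refl (<ℓ k+1+r≡ℓ) ∷ Qb (suc k) ≤-refl (<ℓ k+1+r≡ℓ) ∷
        All-rest Q r (suc k) (next k+1+r≡ℓ) (λ i k<i → Qa i (<⇒≤ k<i)) (λ i 1+k<i → Qb i (<-trans (n<1+n k) 1+k<i))

      unique-rest : ∀ r k → k + r ≡ ℓ → Unique (rest k r)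
      unique-rest zero    k _       = []
      unique-rest (suc r) k k+1+r≡ℓ =
        ((λ a≡b → b≢a (suc k) k k<ℓ k<ℓ (sym a≡b)) ∷
          All-rest (a k ≢_) r (suc k) k+r′
            (λ i k<i i<ℓ a≡a → <⇒≢ k<i (a-injective k i k<ℓ i<ℓ a≡a))
            (λ i _ i≤ℓ a≡b → b≢a i k i≤ℓ k<ℓ (sym a≡b))) ∷
        All-rest (b (suc k) ≢_) r (suc k) k+r′
          (λ i _ i<ℓ b≡a → b≢a (suc k) i k<ℓ i<ℓ b≡a)
          (λ i 1+k<i i≤ℓ b≡b → <⇒≢ 1+k<i (b-injective (suc k) i k<ℓ i≤ℓ b≡b)) ∷
        unique-rest r (suc k) k+r′
        where
        k<ℓ : k < ℓ
        k<ℓ = <ℓ k+1+r≡ℓ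
        k+r′ : suc k + r ≡ ℓ
        k+r′ = next k+1+r≡ℓ

      path-is-st : IsSTPath M₁ M₂ S path
      path-is-st =
        step (arc-s (b∉S 0 z≤n) (indep-⊆ M₁ (∪-mono (λ h → h) (∈⁅⁆⇒⊆ (b∈B 0 z≤n z≤n))) (HalfAugmenting.indep-source half₁)))
          (chain ℓ 0 refl) ,
        All-rest (b 0 ≢_) ℓ 0 refl (λ i _ i<ℓ → b≢a 0 i z≤n i<ℓ)
          (λ i 0<i i≤ℓ b≡b → <⇒≢ 0<i (b-injective 0 i z≤n i≤ℓ b≡b)) ∷
        unique-rest ℓ 0 refl

      AvoidsA : ℕ → Fin n → Set
      AvoidsA k x = ∀ i → k ≤ i → i < ℓ → x ≢ a i

      private
        avoids-from : ∀ {k x} → x ≢ a k → AvoidsA (suc k) x → AvoidsA k x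
        avoids-from {k} x≢ak avoids i k≤i i<ℓ with i ≟ k
        ... | yes refl = x≢ak
        ... | no  i≢k  = avoids i (≤∧≢⇒< k≤i (λ k≡i → i≢k (sym k≡i))) i<ℓ

      ∈augRem⁻ : ∀ r k T → k + r ≡ ℓ → ∀ {x} → x ∈ augRem T (rest k r) →
                 (x ∈ T ⊎ ∃ λ i → k < i × i ≤ ℓ × x ≡ b i) × AvoidsA k x
      ∈augRem⁻ zero k T k+0≡ℓ h =
        inj₁ h , λ i k≤i i<ℓ → ⊥-elim (<⇒≱ i<ℓ (subst (_≤ i) (trans (sym (+-identityʳ k)) k+0≡ℓ) k≤i))
      ∈augRem⁻ (suc r) k T k+1+r≡ℓ h with ∈augRem⁻ r (suc k) ((T - a k) ∪ ⁅ b (suc k) ⁆) (next k+1+r≡ℓ) h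
      ... | inj₂ (i , 1+k<i , i≤ℓ , x≡b) , avoids =
        inj₂ (i , <-trans (n<1+n k) 1+k<i , i≤ℓ , x≡b) ,
        avoids-from (λ x≡a → b≢a i k i≤ℓ (<ℓ k+1+r≡ℓ) (trans (sym x≡b) x≡a)) avoids
      ... | inj₁ x∈T′ , avoids with ∪⁻ x∈T′
      ...   | inj₁ x∈T-a = inj₁ (-ˡ x∈T-a) , avoids-from (-ʳ x∈T-a) avoids
      ...   | inj₂ x∈⁅b⁆ =
        inj₂ (suc k , ≤-refl , <ℓ k+1+r≡ℓ , ⁅⁆⁻ x∈⁅b⁆) ,
        avoids-from (λ x≡a → b≢a (suc k) k (<ℓ k+1+r≡ℓ) (<ℓ k+1+r≡ℓ) (trans (sym (⁅⁆⁻ x∈⁅b⁆)) x≡a)) avoids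

      ∈augRem⁺ : ∀ r k T → k + r ≡ ℓ → ∀ {x} → (x ∈ T ⊎ ∃ λ i → k < i × i ≤ ℓ × x ≡ b i) → AvoidsA k x →
                 x ∈ augRem T (rest k r)
      ∈augRem⁺ zero    k T _     (inj₁ x∈T)              _ = x∈T
      ∈augRem⁺ zero    k T k+0≡ℓ (inj₂ (i , k<i , i≤ℓ , _)) _ =
        ⊥-elim (<⇒≱ k<i (subst (i ≤_) (sym (trans (sym (+-identityʳ k)) k+0≡ℓ)) i≤ℓ))
      ∈augRem⁺ (suc r) k T k+1+r≡ℓ {x} x∈ avoids =
        ∈augRem⁺ r (suc k) ((T - a k) ∪ ⁅ b (suc k) ⁆) (next k+1+r≡ℓ) (shift x∈) (λ i 1+k≤i → avoids i (<⇒≤ 1+k≤i))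
        where
        shift : (x ∈ T ⊎ ∃ λ i → k < i × i ≤ ℓ × x ≡ b i) →
                x ∈ (T - a k) ∪ ⁅ b (suc k) ⁆ ⊎ ∃ λ i → suc k < i × i ≤ ℓ × x ≡ b i
        shift (inj₁ x∈T) = inj₁ (∪ˡ (-⁺ x∈T (avoids k ≤-refl (<ℓ k+1+r≡ℓ))))
        shift (inj₂ (i , k<i , i≤ℓ , x≡b)) with i ≟ suc k
        ... | yes refl = inj₁ (∪ʳ (subst (_∈ ⁅ b (suc k) ⁆) (sym x≡b) (x∈⁅x⁆ _)))
        ... | no  i≢1+k = inj₂ (i , ≤∧≢⇒< k<i (λ 1+k≡i → i≢1+k (sym 1+k≡i)) , i≤ℓ , x≡b)

      S′ : Subset n
      S′ = augment S path

      ∈S′⁻ : ∀ {x} → x ∈ S′ → (x ∈ S ⊎ Among ℓ b x) × AvoidsA 0 x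
      ∈S′⁻ h with ∈augRem⁻ ℓ 0 (S ∪ ⁅ b 0 ⁆) refl h
      ... | inj₂ (i , _ , i≤ℓ , x≡b) , avoids = inj₂ (i , i≤ℓ , x≡b) , avoids
      ... | inj₁ x∈S+b₀ , avoids with ∪⁻ x∈S+b₀
      ...   | inj₁ x∈S   = inj₁ x∈S , avoids
      ...   | inj₂ x∈⁅b⁆ = inj₂ (0 , z≤n , ⁅⁆⁻ x∈⁅b⁆) , avoids

      ∈S′⁺ : ∀ {x} → x ∈ S ⊎ Among ℓ b x → AvoidsA 0 x → x ∈ S′
      ∈S′⁺ x∈ = ∈augRem⁺ ℓ 0 (S ∪ ⁅ b 0 ⁆) refl (shift x∈)
        where
        shift : ∀ {x} → x ∈ S ⊎ Among ℓ b x → x ∈ S ∪ ⁅ b 0 ⁆ ⊎ ∃ λ i → 0 < i × i ≤ ℓ × x ≡ b i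
        shift (inj₁ x∈S)                = inj₁ (∪ˡ x∈S)
        shift (inj₂ (zero  , _ , refl)) = inj₁ (∪ʳ (x∈⁅x⁆ _))
        shift (inj₂ (suc i , i≤ℓ , x≡b)) = inj₂ (suc i , s≤s z≤n , i≤ℓ , x≡b)

      B′ A′ : ℕ → Subset n
      B′ i = B i - b i
      A′ i = A i - a i

      shape′ : Shape S′ B′ A′ w
      shape′ = record
        { B∩S=∅      = B′∩S′=∅
        ; A⊆S        = λ i i<ℓ x∈ → ∈S′⁺ (inj₁ (A⊆S i i<ℓ (-ˡ x∈))) λ m _ m<ℓ x≡a →
                         -ʳ x∈ (trans x≡a (cong a (A-disjoint m i m<ℓ i<ℓ (subst (_∈ A m) (sym x≡a) (a∈A m z≤n m<ℓ)) (-ˡ x∈))))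
        ; B-disjoint = λ i j i≤ℓ j≤ℓ x∈ x∈′ → B-disjoint i j i≤ℓ j≤ℓ (-ˡ x∈) (-ˡ x∈′)
        ; A-disjoint = λ i j i<ℓ j<ℓ x∈ x∈′ → A-disjoint i j i<ℓ j<ℓ (-ˡ x∈) (-ˡ x∈′)
        ; ∣B∣        = λ i i≤ℓ → suc-injective (trans (1+∣p-x∣≡∣p∣ (B i) (b i) (b∈B i z≤n i≤ℓ)) (∣B∣ i i≤ℓ))
        ; ∣A∣        = λ i i<ℓ → suc-injective (trans (1+∣p-x∣≡∣p∣ (A i) (a i) (a∈A i z≤n i<ℓ)) (∣A∣ i i<ℓ))
        }
        where
        B′∩S′=∅ : ∀ i {x} → i ≤ ℓ → x ∈ B′ i → x ∉ S′
        B′∩S′=∅ i i≤ℓ x∈ x∈S′ with proj₁ (∈S′⁻ x∈S′)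
        ... | inj₁ x∈S = B∩S=∅ i i≤ℓ (-ˡ x∈) x∈S
        ... | inj₂ (m , m≤ℓ , x≡b) =
          -ʳ x∈ (trans x≡b (cong b (B-disjoint m i m≤ℓ i≤ℓ (subst (_∈ B m) (sym x≡b) (b∈B m z≤n m≤ℓ)) (-ˡ x∈))))

      half₁′ : HalfAugmenting M₁ ℓ S′ B′ (λ i → A′ (pred i))
      half₁′ = Augmentation.half-augmenting half₁ (layers₁ shape) b (λ i → a (pred i))
        (λ i i≤ℓ → b∈B i z≤n i≤ℓ) (λ i 1≤i i≤ℓ → a∈A (pred i) z≤n (pred< 1≤i i≤ℓ)) arc S′
        (λ x∈S′ → proj₁ (∈S′⁻ x∈S′) , λ i 1≤i i≤ℓ → proj₂ (∈S′⁻ x∈S′) (pred i) z≤n (pred< 1≤i i≤ℓ))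
        (λ x∈ avoids → ∈S′⁺ x∈ λ i _ i<ℓ → avoids (suc i) (s≤s z≤n) i<ℓ)
        where
        arc : ∀ i → 1 ≤ i → i ≤ ℓ → Indep M₁ ((S - a (pred i)) ∪ ⁅ b i ⁆)
        arc (suc i) _ i<ℓ = arc₁ i z≤n i<ℓ

      half₂′ : HalfAugmenting M₂ ℓ S′ (λ i → B′ (ℓ ∸ i)) (λ i → A′ (ℓ ∸ i))
      half₂′ = Augmentation.half-augmenting half₂ (layers₂ shape) (λ i → b (ℓ ∸ i)) (λ i → a (ℓ ∸ i))
        (λ i _ → b∈B (ℓ ∸ i) z≤n (m∸n≤m ℓ i)) (λ i 1≤i i≤ℓ → a∈A (ℓ ∸ i) z≤n (ℓ∸<ℓ 1≤i i≤ℓ))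
        (λ i 1≤i i≤ℓ → arc₂ (ℓ ∸ i) z≤n (ℓ∸<ℓ 1≤i i≤ℓ)) S′
        (λ x∈S′ → reverse (proj₁ (∈S′⁻ x∈S′)) , λ i 1≤i i≤ℓ → proj₂ (∈S′⁻ x∈S′) (ℓ ∸ i) z≤n (ℓ∸<ℓ 1≤i i≤ℓ))
        (λ x∈ avoids → ∈S′⁺ (unreverse x∈) λ i _ i<ℓ →
          subst (λ m → _ ≢ a m) (m∸[m∸n]≡n (<⇒≤ i<ℓ)) (avoids (ℓ ∸ i) (m<n⇒0<n∸m i<ℓ) (m∸n≤m ℓ i)))
        where
        reverse : ∀ {x} → x ∈ S ⊎ Among ℓ b x → x ∈ S ⊎ Among ℓ (λ i → b (ℓ ∸ i)) x
        reverse (inj₁ x∈S)              = inj₁ x∈S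
        reverse (inj₂ (i , i≤ℓ , x≡b)) = inj₂ (ℓ ∸ i , m∸n≤m ℓ i , trans x≡b (cong b (sym (m∸[m∸n]≡n i≤ℓ))))
        unreverse : ∀ {x} → x ∈ S ⊎ Among ℓ (λ i → b (ℓ ∸ i)) x → x ∈ S ⊎ Among ℓ b x
        unreverse (inj₁ x∈S)              = inj₁ x∈S
        unreverse (inj₂ (i , _ , x≡b)) = inj₂ (ℓ ∸ i , m∸n≤m ℓ i , x≡b)

      invariant′ : Invariant S′ B′ A′ w
      invariant′ = record { shape = shape′ ; half₁ = half₁′ ; half₂ = half₂′ }

  Consecutive : Subset n → ℕ → Set
  Consecutive S w = ∃[ P ] (length P ≡ w × ConsecutiveShortest M₁ M₂ ℓ S P)

  consecutive-paths : ∀ w {S B A} → Invariant S B A w → Consecutive S w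
  consecutive-paths zero    _ = [] , refl , tt
  consecutive-paths (suc w) {S} {B} inv =
    start-at (∣p∣>0⇒∃∈ (B 0) (subst (0 <_) (sym (Shape.∣B∣ (Invariant.shape inv) 0 z≤n)) (s≤s z≤n)))
    where
    start-at : (∃ λ b₀ → b₀ ∈ B 0) → Consecutive S (suc w)
    start-at (b₀ , b₀∈B) = prepend (consecutive-paths w R.invariant′)
      where
      module R = Step.Route inv (Step.path-from inv ℓ 0 (+-identityʳ ℓ) b₀ b₀∈B)
      prepend : Consecutive R.S′ w → Consecutive S (suc w)
      prepend (P , ∣P∣≡w , P-consecutive) = R.path ∷ P , cong suc ∣P∣≡w , R.length-path , R.path-is-st , P-consecutive

  module Initial {S : Subset n} (iS₁ : Indep M₁ S) (iS₂ : Indep M₂ S) {w : ℕ}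
                 (dist-t : DistFromS M₁ M₂ S t (2 * suc ℓ)) (Π : AugmentingSet M₁ M₂ S ℓ w) where
    open AugmentingSet Π
    open ExchangeGraph M₁ M₂ S

    Bℕ Aℕ : ℕ → Subset n
    Bℕ = indexOr S B
    Aℕ = indexOr S A

    dist-B : ∀ i {x} → i ≤ ℓ → x ∈ Bℕ i → InD M₁ M₂ S (suc (2 * i)) x
    dist-B i i≤ℓ = indexOr-elim (λ i X → ∀ {x} → x ∈ X → InD M₁ M₂ S (suc (2 * i)) x) S B
                     (λ k {x} → B⊆D k x) i (s≤s i≤ℓ)

    dist-A : ∀ i {x} → i < ℓ → x ∈ Aℕ i → InD M₁ M₂ S (2 * suc i) x
    dist-A i i<ℓ = indexOr-elim (λ i X → ∀ {x} → x ∈ X → InD M₁ M₂ S (2 * suc i) x) S A (λ k {x} → A⊆D k x) i i<ℓ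

    B∩S=∅ : ∀ i {x} → i ≤ ℓ → x ∈ Bℕ i → x ∉ S
    B∩S=∅ i i≤ℓ x∈ = odd-walk⇒∉ i (proj₁ (dist-B i i≤ℓ x∈))

    A⊆S : ∀ i {x} → i < ℓ → x ∈ Aℕ i → x ∈ S
    A⊆S i i<ℓ x∈ = even-walk⇒∈ (suc i) (proj₁ (dist-A i i<ℓ x∈))

    shape : Shape S Bℕ Aℕ w
    shape = record
      { B∩S=∅ = B∩S=∅ ; A⊆S = A⊆S
      ; B-disjoint = λ i j i≤ℓ j≤ℓ x∈ x∈′ →
          *-cancelˡ-≡ i j 2 (suc-injective (InD-unique (dist-B i i≤ℓ x∈) (dist-B j j≤ℓ x∈′)))
      ; A-disjoint = λ i j i<ℓ j<ℓ x∈ x∈′ →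
          suc-injective (*-cancelˡ-≡ (suc i) (suc j) 2 (InD-unique (dist-A i i<ℓ x∈) (dist-A j j<ℓ x∈′)))
      ; ∣B∣ = λ i i≤ℓ → indexOr-elim (λ _ X → ∣ X ∣ ≡ w) S B ∣B∣ i (s≤s i≤ℓ)
      ; ∣A∣ = indexOr-elim (λ _ X → ∣ X ∣ ≡ w) S A ∣A∣ }

    two-suc : ∀ m → suc (suc (2 * m)) ≡ 2 * suc m
    two-suc m = cong suc (sym (+-suc m (m + 0)))

    half₁ : HalfAugmenting M₁ ℓ S Bℕ (λ i → Aℕ (pred i))
    half₁ = record
      { indep = iS₁ ; indep-source = first ; indep-swap = swap ; no-shortcut₁ = no-shortcut₁ ; no-shortcut₂ = no-shortcut₂ }
      where
      swap : ∀ i → 1 ≤ i → i ≤ ℓ → Indep M₁ ((S ─ Aℕ (pred i)) ∪ Bℕ i)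
      swap (suc i) _ i<ℓ = indexOr-elim (λ i X → Indep M₁ ((S ─ X) ∪ Bℕ (suc i))) S A
        (λ k → subst (λ Y → Indep M₁ ((S ─ A k) ∪ Y)) (sym (indexOr-toℕ S B (suc k))) (exch₁ k)) i i<ℓ
      no-shortcut₁ : ∀ i {z} → 1 ≤ i → i ≤ ℓ → z ∈ Bℕ i → ¬ Indep M₁ (S ∪ ⁅ z ⁆)
      no-shortcut₁ (suc i) _ i<ℓ z∈ iS+z =
        ¬shorter-walk (dist-B (suc i) i<ℓ z∈) (arc-s (B∩S=∅ (suc i) i<ℓ z∈) iS+z ∷ []) (s≤s (s≤s z≤n))
      no-shortcut₂ : ∀ i j {z y} → 1 ≤ j → j < i → i ≤ ℓ → z ∈ Bℕ i → y ∈ Aℕ (pred j) → ¬ Indep M₁ ((S - y) ∪ ⁅ z ⁆)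
      no-shortcut₂ i (suc j) _ 1+j<i i≤ℓ z∈ y∈ iS-y+z =
        ¬shorter-walk (dist-B i i≤ℓ z∈) (proj₁ (dist-A j j<ℓ y∈) ∷ʳ arc-ab (A⊆S j j<ℓ y∈) (B∩S=∅ i i≤ℓ z∈) iS-y+z)
          (s≤s (*-monoʳ-< 2 1+j<i))
        where
        j<ℓ : j < ℓ
        j<ℓ = ≤-trans (n≤1+n (suc j)) (≤-trans 1+j<i i≤ℓ)

    half₂ : HalfAugmenting M₂ ℓ S (λ i → Bℕ (ℓ ∸ i)) (λ i → Aℕ (ℓ ∸ i))
    half₂ = record
      { indep = iS₂ ; indep-source = source ; indep-swap = swap ; no-shortcut₁ = no-shortcut₁ ; no-shortcut₂ = no-shortcut₂ }
      where
      source : Indep M₂ (S ∪ Bℕ ℓ)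
      source = subst (λ m → Indep M₂ (S ∪ Bℕ m)) (toℕ-fromℕ ℓ)
                 (subst (λ Y → Indep M₂ (S ∪ Y)) (sym (indexOr-toℕ S B (fromℕ ℓ))) last)
      swap : ∀ i → 1 ≤ i → i ≤ ℓ → Indep M₂ ((S ─ Aℕ (ℓ ∸ i)) ∪ Bℕ (ℓ ∸ i))
      swap i 1≤i i≤ℓ = indexOr-elim (λ m X → Indep M₂ ((S ─ X) ∪ Bℕ m)) S A
        (λ k → subst (λ Y → Indep M₂ ((S ─ A k) ∪ Y))
                 (sym (trans (cong Bℕ (sym (toℕ-inject₁ k))) (indexOr-toℕ S B (inject₁ k)))) (exch₂ k))
        (ℓ ∸ i) (ℓ∸<ℓ 1≤i i≤ℓ)
      no-shortcut₁ : ∀ i {z} → 1 ≤ i → i ≤ ℓ → z ∈ Bℕ (ℓ ∸ i) → ¬ Indep M₂ (S ∪ ⁅ z ⁆)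
      no-shortcut₁ i 1≤i i≤ℓ z∈ iS+z =
        ¬shorter-walk dist-t (proj₁ (dist-B (ℓ ∸ i) (m∸n≤m ℓ i) z∈) ∷ʳ arc-t (B∩S=∅ (ℓ ∸ i) (m∸n≤m ℓ i) z∈) iS+z)
          (subst (_< 2 * suc ℓ) (sym (two-suc (ℓ ∸ i))) (*-monoʳ-< 2 (s≤s (ℓ∸<ℓ 1≤i i≤ℓ))))
      no-shortcut₂ : ∀ i j {z y} → 1 ≤ j → j < i → i ≤ ℓ → z ∈ Bℕ (ℓ ∸ i) → y ∈ Aℕ (ℓ ∸ j) →
                     ¬ Indep M₂ ((S - y) ∪ ⁅ z ⁆)
      no-shortcut₂ i j 1≤j j<i i≤ℓ z∈ y∈ iS-y+z =
        ¬shorter-walk (dist-A (ℓ ∸ j) ℓ∸j<ℓ y∈)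
          (proj₁ (dist-B (ℓ ∸ i) (m∸n≤m ℓ i) z∈) ∷ʳ arc-ba (A⊆S (ℓ ∸ j) ℓ∸j<ℓ y∈) (B∩S=∅ (ℓ ∸ i) (m∸n≤m ℓ i) z∈) iS-y+z)
          (subst (_< 2 * suc (ℓ ∸ j)) (sym (two-suc (ℓ ∸ i))) (*-monoʳ-< 2 (s≤s (∸-monoʳ-< j<i i≤ℓ))))
        where
        ℓ∸j<ℓ : ℓ ∸ j < ℓ
        ℓ∸j<ℓ = ℓ∸<ℓ 1≤j (≤-trans (<⇒≤ j<i) i≤ℓ)

    invariant : Invariant S Bℕ Aℕ w
    invariant = record { shape = shape ; half₁ = half₁ ; half₂ = half₂ }

theorem6p14 : ∀ {n : ℕ} (M₁ M₂ : Matroid n) (S : Subset n) →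
    Indep M₁ S → Indep M₂ S → (ℓ w : ℕ) →
    DistFromS M₁ M₂ S t (2 * suc ℓ) →
    AugmentingSet M₁ M₂ S ℓ w →
    ∃[ P ] (length P ≡ w × ConsecutiveShortest M₁ M₂ ℓ S P)
theorem6p14 M₁ M₂ S iS₁ iS₂ ℓ w dist-t Π = consecutive-paths w (Initial.invariant iS₁ iS₂ dist-t Π)
  where open Augmenting M₁ M₂ ℓ
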